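{- Let $\phi:\Lambda\to\widetilde{\Lambda}$ be the algebra homomorphism (for the ordinary product on $\Lambda$ and $\odot$ on $\widetilde\Lambda$) with $\phi(p_1)=\widetilde m_1$, $\phi(p_2)=-\widetilde m_2$, $\phi(p_n)=0$ for $n\ge3$, and let $\theta:\widetilde\Lambda\to\widetilde\Lambda$ be the $\odot$-algebra homomorphism with $\theta(\widetilde m_1)=\widetilde m_1$, $\theta(\widetilde m_2)=\widetilde m_2$, $\theta(\widetilde m_n)=0$ for $n\ge3$. Then $\phi(X_G)=\theta(X_{\overline{G}})$ for every unweighted graph $G$.
   Context: Work over a field $\mathbb{K}$ of characteristic $0$. Unweighted graph: finite simple graph with all vertex weights $1$; $\overline{G}$ complement; $X_G=\sum_\kappa\prod_v x_{\kappa(v)}$ over proper colorings $\kappa:V(G)\to\{1,2,\dots\}$. $\Lambda$ is the ring of symmetric functions, $p_n=\sum_ix_i^n$. $\widetilde m_\lambda=m_\lambda\prod_i r_i(\lambda)!$ ($m_\lambda$ monomial symmetric function, $r_i(\lambda)$ multiplicity of $i$), $\widetilde m_n=p_n$. $\widetilde\Lambda$ is the vector space $\Lambda$ with product $\odot$ given by $\widetilde m_\lambda\odot\widetilde m_\mu=\widetilde m_{\lambda\sqcup\mu}$, $\lambda\sqcup\mu$ being the union of the parts; its $\widetilde m_n$ are algebraically independent generators. -}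

module Defs where

open import Data.Bool using (Bool; true; false; not; _∧_; if_then_else_)
open import Data.Nat as ℕ using (ℕ; zero; suc; _≡ᵇ_; _≤ᵇ_)
open import Data.Nat.Base using (_!)
open import Relation.Nullary using (yes; no)
open import Data.Empty using (⊥-elim)
import Data.List
import Data.Product
open import Data.Fin using (Fin; zero; suc)
open import Data.Fin.Properties using (_≟_)
open import Data.List using (List; []; _∷_; [_]; map; concatMap; filter; length; allFin; foldr; _++_)
import Data.List.Properties as LP
open import Data.List.Relation.Unary.All using (All)
open import Data.Product using (_×_; _,_)
open import Data.Integer using (+_)
open import Data.Rational using (ℚ; 0ℚ; 1ℚ; _+_; _*_; -_; _/_)
open import Relation.Nullary.Decidable using (⌊_⌋; does)
open import Relation.Binary.PropositionalEquality using (_≡_; refl)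

record Graph (n : ℕ) : Set where
  field
    adj    : Fin n → Fin n → Bool
    sym    : ∀ u v → adj u v ≡ adj v u
    irrefl : ∀ v → adj v v ≡ false
open Graph public

private
  eqᵇ : ∀ {n} → Fin n → Fin n → Bool
  eqᵇ u v = ⌊ u ≟ v ⌋

  eqᵇ-sym : ∀ {n} (u v : Fin n) → eqᵇ u v ≡ eqᵇ v u
  eqᵇ-sym u v with u ≟ v | v ≟ u
  ... | yes _ | yes _ = refl
  ... | no _  | no _  = refl
  ... | yes refl | no ¬p = ⊥-elim (¬p refl)
  ... | no ¬p | yes refl = ⊥-elim (¬p refl)

  eqᵇ-refl : ∀ {n} (v : Fin n) → eqᵇ v v ≡ true
  eqᵇ-refl v with v ≟ v
  ... | yes _ = refl
  ... | no ¬p = ⊥-elim (¬p refl)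

  cadj : ∀ {n} → Graph n → Fin n → Fin n → Bool
  cadj G u v = not (adj G u v) ∧ not (eqᵇ u v)

  cadj-sym : ∀ {n} (G : Graph n) u v → cadj G u v ≡ cadj G v u
  cadj-sym G u v rewrite sym G u v | eqᵇ-sym u v = refl

  cadj-irrefl : ∀ {n} (G : Graph n) v → cadj G v v ≡ false
  cadj-irrefl G v rewrite eqᵇ-refl v with not (adj G v v)
  ... | true = refl
  ... | false = refl

complement : ∀ {n} → Graph n → Graph n
complement G = record { adj = cadj G ; sym = cadj-sym G ; irrefl = cadj-irrefl G }

allFuns : (m k : ℕ) → List (Fin m → Fin k)
allFuns zero    k = [ (λ ()) ]
allFuns (suc m) k = concatMap (λ f → map (λ c → cons c f) (allFin k)) (allFuns m k)
  where
    cons : Fin k → (Fin m → Fin k) → Fin (suc m) → Fin k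
    cons c f zero    = c
    cons c f (suc i) = f i

sumFin : (m : ℕ) → (Fin m → ℕ) → ℕ
sumFin zero    f = 0
sumFin (suc m) f = f zero ℕ.+ sumFin m (λ i → f (suc i))

ℕtoℚ : ℕ → ℚ
ℕtoℚ k = + k / 1

countᵇ : ∀ {A : Set} → (A → Bool) → List A → ℕ
countᵇ p xs = length (filter (λ x → Relation.Nullary.Decidable.T? (p x)) xs)

allB : ∀ {A : Set} → (A → Bool) → List A → Bool
allB q xs = foldr (λ x acc → q x ∧ acc) true xs

-- Polynomials in the n variables x_0,…,x_{n-1} over ℚ, represented by
-- their coefficient function on exponent vectors α : Fin n → ℕ.
-- (Λ in degree n embeds injectively into such polynomials.)

Exp : ℕ → Set
Exp n = Fin n → ℕ

Poly : ℕ → Set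
Poly n = Exp n → ℚ

-- Chromatic symmetric function X_G (in the variables x_0..x_{n-1}):
-- coefficient of x^α = number of proper colourings κ : V → {0..n-1}
-- with |κ⁻¹(i)| = α i for all i.

isProper : ∀ {n} → Graph n → (Fin n → Fin n) → Bool
isProper {n} G κ =
  allB (λ u → allB (λ v → not (adj G u v) ∨' not (eqᵇ (κ u) (κ v))) (allFin n)) (allFin n)
  where
    _∨'_ : Bool → Bool → Bool
    true ∨' _ = true
    false ∨' b = b

colourContent : ∀ {m n} → (Fin m → Fin n) → Exp n
colourContent {m} κ i = countᵇ (λ v → eqᵇ (κ v) i) (allFin m)

expEq : ∀ {n} → Exp n → Exp n → Bool
expEq {n} α β = allB (λ i → α i ≡ᵇ β i) (allFin n)

X : ∀ {n} → Graph n → Poly n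
X {n} G α = ℕtoℚ (countᵇ (λ κ → isProper G κ ∧ expEq (colourContent κ) α) (allFuns n n))

-- Partitions are lists of positive parts; λ ⊔ μ is list concatenation.

-- power sum p_λ = ∏_j p_{λ_j}, p_k = Σ_i x_i^k; expanding the product,
-- coefficient of x^α = #{ f : parts → variables | Σ_{j, f j = i} λ_j = α i }
partContent : ∀ {n} (λ' : List ℕ) → (Fin (length λ') → Fin n) → Exp n
partContent λ' f i =
  sumFin (length λ') (λ j → if eqᵇ (f j) i then Data.List.lookup λ' j else 0)

p : ∀ {n} → List ℕ → Poly n
p {n} λ' α = ℕtoℚ (countᵇ (λ f → expEq (partContent λ' f) α) (allFuns (length λ') n))

insert : ℕ → List ℕ → List ℕ
insert x [] = [ x ]
insert x (y ∷ ys) = if y ≤ᵇ x then x ∷ y ∷ ys else y ∷ insert x ys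

sortDesc : List ℕ → List ℕ
sortDesc = foldr insert []

listEqᵇ : List ℕ → List ℕ → Bool
listEqᵇ [] [] = true
listEqᵇ (x ∷ xs) (y ∷ ys) = (x ≡ᵇ y) ∧ listEqᵇ xs ys
listEqᵇ _ _ = false

expList : ∀ {n} → Exp n → List ℕ
expList {n} α = map α (allFin n)

-- monomial symmetric function m_λ: coefficient of x^α is 1 iff the
-- multiset of nonzero entries of α equals the multiset of parts of λ
m : ∀ {n} → List ℕ → Poly n
m λ' α = if listEqᵇ (sortDesc (filter (λ k → Relation.Nullary.Decidable.¬? (k ℕ.≟ 0)) (expList α)))
                   (sortDesc λ')
         then 1ℚ else 0ℚ

-- r_i(λ) = multiplicity of i in λ; ∏_i r_i(λ)!
multFactorial : List ℕ → ℕ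
multFactorial λ' = foldr (λ i acc → (countᵇ (λ k → k ≡ᵇ i) λ') ! ℕ.* acc) 1
                         (Data.List.deduplicate ℕ._≟_ λ')

m̃ : ∀ {n} → List ℕ → Poly n
m̃ λ' α = ℕtoℚ (multFactorial λ') * m λ' α

-- Formal ℚ-linear combinations of basis elements indexed by partitions.

LinComb : Set
LinComb = List (ℚ × List ℕ)

IsPartitionOf : ℕ → List ℕ → Set
IsPartitionOf n λ' = All (λ k → 1 ℕ.≤ k) λ' × (foldr ℕ._+_ 0 λ' ≡ n)

Homogeneous : ℕ → LinComb → Set
Homogeneous n E = All (λ qλ → IsPartitionOf n (Data.Product.proj₂ qλ)) E

eval : ∀ {n} → (List ℕ → Poly n) → LinComb → Poly n
eval b [] α = 0ℚ
eval b ((q , λ') ∷ E) α = q * b λ' α + eval b E α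

-- Λ̃ : elements are linear combinations in the m̃ basis, with
-- m̃_λ ⊙ m̃_μ = m̃_{λ ⊔ μ}, extended bilinearly.

_⊙_ : LinComb → LinComb → LinComb
E ⊙ F = concatMap (λ { (q , λ') → map (λ { (r , μ) → (q * r , λ' ++ μ) }) F }) E

onẽ : LinComb
onẽ = [ (1ℚ , []) ]

scale : ℚ → LinComb → LinComb
scale q = map (λ { (r , μ) → (q * r , μ) })

φgen : ℕ → LinComb
φgen 1 = [ (1ℚ , [ 1 ]) ]
φgen 2 = [ (- 1ℚ , [ 2 ]) ]
φgen _ = []

φ : LinComb → LinComb
φ = concatMap (λ { (q , λ') → scale q (foldr (λ k acc → φgen k ⊙ acc) onẽ λ') })

θgen : ℕ → LinComb
θgen 1 = [ (1ℚ , [ 1 ]) ]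
θgen 2 = [ (1ℚ , [ 2 ]) ]
θgen _ = []

θ : LinComb → LinComb
θ = concatMap (λ { (q , λ') → scale q (foldr (λ k acc → θgen k ⊙ acc) onẽ λ') })

-- Coefficients are compared monomial by monomial.  Both p_λ and X_G are sums, over maps ψ
-- from a finite set (the parts of λ, the vertices of G) to the variables, of products
-- ∏_c w_{α c} (ψ⁻¹ c): the parts in a class must add up to α c, resp. a class must be an
-- independent set of size α c.  If α has no entry above 2 and at least as many entries 0
-- as entries 2, match each 2-entry a with a 0-entry b and apply the linear functional
-- h ↦ ½ h(α with x_a² turned into x_a x_b) − h(α).  On such sums it merges the classes of
-- a and b and replaces the weight at a by ½ (w₁ ⊛ w₁) − w₂, with ⊛ the subset convolution:
-- for X_G this is the indicator of an edge of G, i.e. of an independent pair of the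
-- complement, so X_G goes to X_Ḡ at α; for p_λ it is minus the indicator of a single part
-- 2, which yields the coefficient of φ(p_λ) at α.  Linearity turns X_G = ∑ c_λ p_λ into
-- φ(X_G) at α, and θ does not change coefficients at such α.  For any other α every m̃
-- of a partition of n into ones and twos vanishes at α (an exponent above 2, or a degree
-- above n), so both sides are 0.

module Submission where

open import Defs hiding (sym)
open import Data.Nat using (ℕ)
open import Relation.Binary.PropositionalEquality using (_≡_)

open import Algebra.Bundles using (CommutativeMonoid; CommutativeRing; Semiring)
open import Data.Bool using (Bool; true; false; not; _∧_; _∨_; if_then_else_; T)
open import Data.Bool.Properties using (∧-zeroʳ; ∧-idem; ∧-comm; ∨-zeroʳ; ¬-not)
open import Data.Empty using (⊥; ⊥-elim)
open import Data.Fin using (Fin; zero; suc; punchIn; punchOut)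
open import Data.Fin.Properties
  using (_≟_; suc-injective; punchInᵢ≢i; punchIn-injective; punchIn-punchOut; all?; ¬∀⟶∃¬)
open import Data.Fin.Subset using (Subset; ∣_∣)
open import Data.Fin.Subset.Properties using (∣p∣≤∣x∷p∣)
import Data.Integer as ℤ
import Data.Integer.Properties as ℤ
open import Data.List
  using (List; []; _∷_; _++_; map; filter; length; tabulate; allFin; concatMap; replicate; deduplicate; foldr; zip)
open import Data.List.Membership.Propositional using (_∈_)
open import Data.List.Membership.Propositional.Properties using (∈-filter⁺; ∈-allFin)
open import Data.List.Properties using (length-++; filter-++; map-tabulate)
open import Data.List.Relation.Unary.All as All using (All; []; _∷_)
open import Data.List.Relation.Unary.All.Properties using (all-filter)
open import Data.List.Relation.Unary.AllPairs using (AllPairs; []; _∷_)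
open import Data.List.Relation.Unary.Any using (here; there)
open import Data.List.Relation.Unary.Unique.Propositional.Properties
  using (allFin⁺) renaming (filter⁺ to Unique-filter⁺)
open import Data.Nat as ℕ using (suc; zero; _≡ᵇ_; _≤_; _<_; s≤s; z≤n; _!)
import Data.Nat.Coprimality as Coprime
import Data.Nat.Properties as ℕ
open import Algebra.Properties.CommutativeSemigroup ℕ.+-commutativeSemigroup using (x∙yz≈y∙xz)
open import Data.Product using (∃; ∃₂; _×_; _,_; proj₁; proj₂)
open import Data.Rational using (ℚ; 0ℚ; 1ℚ; ½; _+_; _*_; -_; _-_; mkℚ)
open import Data.Rational.Properties
  using (+-*-commutativeRing; +-0-commutativeMonoid; *-1-commutativeMonoid; normalize-coprime; /-cong;
         +-assoc; +-identityˡ; +-identityʳ; *-identityˡ; *-identityʳ; *-zeroˡ; *-zeroʳ)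
  renaming (_≟_ to _≟ℚ_)
open import Data.Sum as Sum using (_⊎_; inj₁; inj₂; [_,_]′)
open import Data.Unit using (tt)
open import Data.Vec using ([]; _∷_; lookup) renaming (tabulate to vtabulate)
open import Data.Vec.Functional using (updateAt)
open import Data.Vec.Functional.Properties using (updateAt-updates; updateAt-minimal)
open import Data.Vec.Properties using (lookup∘tabulate)
open import Function using (_∘_; id; const)
open import Level using (0ℓ)
open import Relation.Binary.PropositionalEquality
  using (refl; sym; trans; cong; cong₂; subst; subst₂; _≢_; ≢-sym; _≗_; module ≡-Reasoning)
open import Relation.Nullary using (yes; no)
open import Relation.Nullary.Decidable using (⌊_⌋; ¬?; dec⇒maybe)
open import Tactic.RingSolver using (solve-∀)
open import Tactic.RingSolver.Core.AlmostCommutativeRing using (AlmostCommutativeRing; fromCommutativeRing)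

ℚ-semiring : Semiring 0ℓ 0ℓ
ℚ-semiring = CommutativeRing.semiring +-*-commutativeRing

open import Algebra.Properties.Semiring.Sum ℚ-semiring
  using (sum; sum-cong-≗; sum-replicate-zero; ∑-distrib-+; *-distribˡ-sum; *-distribʳ-sum)
open import Algebra.Properties.Semiring.Mult ℚ-semiring using (×-homo-+; ×1-homo-*) renaming (_×_ to _×ℚ_)
open import Algebra.Properties.CommutativeMonoid.Sum *-1-commutativeMonoid
  using () renaming (sum to prod; sum-cong-≗ to prod-cong-≗; sum-replicate-zero to prod-replicate-one;
                     sum-remove to prod-remove; ∑-distrib-+ to prod-distrib-*)

ℚ-ring : AlmostCommutativeRing 0ℓ 0ℓ
ℚ-ring = fromCommutativeRing +-*-commutativeRing (λ x → dec⇒maybe (0ℚ ≟ℚ x))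

𝟙 : Bool → ℚ
𝟙 true  = 1ℚ
𝟙 false = 0ℚ

𝟙-∧ : ∀ a b → 𝟙 (a ∧ b) ≡ 𝟙 a * 𝟙 b
𝟙-∧ true  b = sym (*-identityˡ (𝟙 b))
𝟙-∧ false b = sym (*-zeroˡ (𝟙 b))

true≢false : true ≢ false
true≢false ()

if-𝟙 : ∀ b → (if b then 1ℚ else 0ℚ) ≡ 𝟙 b
if-𝟙 true  = refl
if-𝟙 false = refl

ℕtoℚ-if : ∀ b → ℕtoℚ (if b then 1 else 0) ≡ 𝟙 b
ℕtoℚ-if true  = refl
ℕtoℚ-if false = refl

≡ᵇ⇒≡ : ∀ {a b} → (a ≡ᵇ b) ≡ true → a ≡ b
≡ᵇ⇒≡ {a} {b} eq = ℕ.≡ᵇ⇒≡ a b (subst T (sym eq) tt)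

≡ᵇ-refl : ∀ v → (v ≡ᵇ v) ≡ true
≡ᵇ-refl zero    = refl
≡ᵇ-refl (suc v) = ≡ᵇ-refl v

≡ᵇ-false⇒≢ : ∀ {a b} → (a ≡ᵇ b) ≡ false → a ≢ b
≡ᵇ-false⇒≢ {a} a≢ᵇa refl with trans (sym (≡ᵇ-refl a)) a≢ᵇa
... | ()

-- Rewriting with this explicitly keeps conversion checking away from ℚ arithmetic on open
-- terms, which is extremely slow.
ℕtoℚ-zero : ℕtoℚ 0 ≡ 0ℚ
ℕtoℚ-zero = refl

ℕtoℚ-suc : ∀ k → ℕtoℚ (suc k) ≡ 1ℚ + ℕtoℚ k
ℕtoℚ-suc k = trans (/-cong {p₁ = ℤ.+ suc k} (sym (cong (ℤ._+_ (ℤ.+ 1)) (ℤ.*-identityʳ (ℤ.+ k)))) refl)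
                   (cong (1ℚ +_) (sym ℕtoℚ≡mkℚ))
  where
  ℕtoℚ≡mkℚ : ℕtoℚ k ≡ mkℚ (ℤ.+ k) 0 (Coprime.sym (Coprime.1-coprimeTo k))
  ℕtoℚ≡mkℚ = normalize-coprime (Coprime.sym (Coprime.1-coprimeTo k))

ℕtoℚ≡×1 : ∀ k → ℕtoℚ k ≡ k ×ℚ 1ℚ
ℕtoℚ≡×1 zero    = refl
ℕtoℚ≡×1 (suc k) = trans (ℕtoℚ-suc k) (cong (1ℚ +_) (ℕtoℚ≡×1 k))

ℕtoℚ-+ : ∀ a b → ℕtoℚ (a ℕ.+ b) ≡ ℕtoℚ a + ℕtoℚ b
ℕtoℚ-+ a b = begin
  ℕtoℚ (a ℕ.+ b)      ≡⟨ ℕtoℚ≡×1 (a ℕ.+ b) ⟩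
  (a ℕ.+ b) ×ℚ 1ℚ      ≡⟨ ×-homo-+ 1ℚ a b ⟩
  a ×ℚ 1ℚ + b ×ℚ 1ℚ     ≡⟨ sym (cong₂ _+_ (ℕtoℚ≡×1 a) (ℕtoℚ≡×1 b)) ⟩
  ℕtoℚ a + ℕtoℚ b     ∎
  where open ≡-Reasoning

ℕtoℚ-* : ∀ a b → ℕtoℚ (a ℕ.* b) ≡ ℕtoℚ a * ℕtoℚ b
ℕtoℚ-* a b = begin
  ℕtoℚ (a ℕ.* b)      ≡⟨ ℕtoℚ≡×1 (a ℕ.* b) ⟩
  (a ℕ.* b) ×ℚ 1ℚ      ≡⟨ ×1-homo-* a b ⟩
  a ×ℚ 1ℚ * (b ×ℚ 1ℚ)   ≡⟨ sym (cong₂ _*_ (ℕtoℚ≡×1 a) (ℕtoℚ≡×1 b)) ⟩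
  ℕtoℚ a * ℕtoℚ b     ∎
  where open ≡-Reasoning

module _ {A : Set} (q : A → Bool) where

  countᵇ-++ : ∀ xs ys → countᵇ q (xs ++ ys) ≡ countᵇ q xs ℕ.+ countᵇ q ys
  countᵇ-++ xs ys = trans (cong length (filter-++ _ xs ys)) (length-++ (filter _ xs))

  countᵇ-∷ : ∀ x xs → countᵇ q (x ∷ xs) ≡ (if q x then 1 else 0) ℕ.+ countᵇ q xs
  countᵇ-∷ x xs with q x
  ... | true  = refl
  ... | false = refl

  ℕtoℚ-countᵇ-∷ : ∀ x xs → ℕtoℚ (countᵇ q (x ∷ xs)) ≡ 𝟙 (q x) + ℕtoℚ (countᵇ q xs)
  ℕtoℚ-countᵇ-∷ x xs = trans (cong ℕtoℚ (countᵇ-∷ x xs)) (ℕtoℚ-indicator+ (q x) (countᵇ q xs))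
    where
    ℕtoℚ-indicator+ : ∀ b k → ℕtoℚ ((if b then 1 else 0) ℕ.+ k) ≡ 𝟙 b + ℕtoℚ k
    ℕtoℚ-indicator+ true  k = ℕtoℚ-suc k
    ℕtoℚ-indicator+ false k = sym (+-identityˡ (ℕtoℚ k))

  ℕtoℚ-countᵇ-tabulate : ∀ {k} (f : Fin k → A) → ℕtoℚ (countᵇ q (tabulate f)) ≡ sum (𝟙 ∘ q ∘ f)
  ℕtoℚ-countᵇ-tabulate {zero}  f = refl
  ℕtoℚ-countᵇ-tabulate {suc k} f =
    trans (ℕtoℚ-countᵇ-∷ (f zero) _) (cong (𝟙 (q (f zero)) +_) (ℕtoℚ-countᵇ-tabulate (f ∘ suc)))

  countᵇ-tabulate : ∀ {k} (f : Fin k → A) → countᵇ q (tabulate f) ≡ ∣ vtabulate (q ∘ f) ∣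
  countᵇ-tabulate {zero}  f = refl
  countᵇ-tabulate {suc k} f with q (f zero)
  ... | true  = cong suc (countᵇ-tabulate (f ∘ suc))
  ... | false = countᵇ-tabulate (f ∘ suc)

  allB-tabulate⁻ : ∀ {k} (f : Fin k → A) → allB q (tabulate f) ≡ true → ∀ i → q (f i) ≡ true
  allB-tabulate⁻ f all zero    with q (f zero) | all
  ... | true | _ = refl
  allB-tabulate⁻ f all (suc i) with q (f zero) | all
  ... | true | rest = allB-tabulate⁻ (f ∘ suc) rest i

  allB-tabulate⁺ : ∀ {k} (f : Fin k → A) → (∀ i → q (f i) ≡ true) → allB q (tabulate f) ≡ true
  allB-tabulate⁺ {zero}  f all = refl
  allB-tabulate⁺ {suc k} f all rewrite all zero = allB-tabulate⁺ (f ∘ suc) (all ∘ suc)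

  allB-tabulate-false : ∀ {k} (f : Fin k → A) → allB q (tabulate f) ≡ false → ∃ λ i → q (f i) ≡ false
  allB-tabulate-false {suc k} f none with q (f zero) in eq
  ... | false = zero , eq
  ... | true  = let i , qi = allB-tabulate-false (f ∘ suc) none in suc i , qi

  𝟙-allB-tabulate : ∀ {k} (f : Fin k → A) → 𝟙 (allB q (tabulate f)) ≡ prod (𝟙 ∘ q ∘ f)
  𝟙-allB-tabulate {zero}  f = refl
  𝟙-allB-tabulate {suc k} f = trans (𝟙-∧ (q (f zero)) _) (cong (𝟙 (q (f zero)) *_) (𝟙-allB-tabulate (f ∘ suc)))

module _ {c ℓ} (M : CommutativeMonoid c ℓ) where
  open CommutativeMonoid M using (Carrier; _≈_; setoid; ∙-cong; ∙-congˡ; assoc) renaming (_∙_ to _+ᴹ_)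
  open CommutativeMonoid M using () renaming (sym to ≈-sym)
  open import Algebra.Properties.CommutativeMonoid.Sum M using () renaming (sum to sumᴹ; sum-remove to sumᴹ-remove; sum-cong-≋ to sumᴹ-cong-≋)
  open import Relation.Binary.Reasoning.Setoid setoid

  sum-cong-off₂ : ∀ {n} {a b : Fin n} → a ≢ b → (f g : Fin n → Carrier)
    → (∀ c → c ≢ a → c ≢ b → f c ≈ g c) → f a +ᴹ f b ≈ g a +ᴹ g b → sumᴹ f ≈ sumᴹ g
  sum-cong-off₂ {suc zero}    {zero} {zero} a≢b = ⊥-elim (a≢b refl)
  sum-cong-off₂ {suc (suc n)} {a}    {b}    a≢b f g f≈g fab≈gab = begin
    sumᴹ f                            ≈⟨ pull f ⟩
    (f a +ᴹ f b) +ᴹ sumᴹ (rest f)     ≈⟨ ∙-cong fab≈gab (sumᴹ-cong-≋ (λ c → f≈g _ (outside₁ c) (outside₂ c))) ⟩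
    (g a +ᴹ g b) +ᴹ sumᴹ (rest g)     ≈⟨ ≈-sym (pull g) ⟩
    sumᴹ g                            ∎
    where
    b′ : Fin (suc n)
    b′ = punchOut a≢b
    rest : (Fin (suc (suc n)) → Carrier) → Fin n → Carrier
    rest h c = h (punchIn a (punchIn b′ c))
    outside₁ : ∀ c → punchIn a (punchIn b′ c) ≢ a
    outside₁ c = punchInᵢ≢i a _
    outside₂ : ∀ c → punchIn a (punchIn b′ c) ≢ b
    outside₂ c eq = punchInᵢ≢i b′ c (punchIn-injective a _ _ (trans eq (sym (punchIn-punchOut a≢b))))
    pull : ∀ h → sumᴹ h ≈ (h a +ᴹ h b) +ᴹ sumᴹ (rest h)
    pull h = begin
      sumᴹ h                                          ≈⟨ sumᴹ-remove {i = a} h ⟩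
      h a +ᴹ sumᴹ (h ∘ punchIn a)                     ≈⟨ ∙-congˡ (sumᴹ-remove {i = b′} (h ∘ punchIn a)) ⟩
      h a +ᴹ (h (punchIn a b′) +ᴹ sumᴹ (rest h))      ≡⟨ cong (λ x → h a +ᴹ (h x +ᴹ sumᴹ (rest h))) (punchIn-punchOut a≢b) ⟩
      h a +ᴹ (h b +ᴹ sumᴹ (rest h))                   ≈⟨ ≈-sym (assoc _ _ _) ⟩
      (h a +ᴹ h b) +ᴹ sumᴹ (rest h)                   ∎

sum-linear : ∀ {k} r s (f g : Fin k → ℚ) → sum (λ i → r * f i + s * g i) ≡ r * sum f + s * sum g
sum-linear r s f g = trans (∑-distrib-+ (λ i → r * f i) (λ i → s * g i))
                           (sym (cong₂ _+_ (*-distribˡ-sum r f) (*-distribˡ-sum s g)))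

sum-zero : ∀ {k} (f : Fin k → ℚ) → (∀ i → f i ≡ 0ℚ) → sum f ≡ 0ℚ
sum-zero {k} f f≡0 = trans (sum-cong-≗ f≡0) (sum-replicate-zero k)

prod-one : ∀ {k} (f : Fin k → ℚ) → (∀ i → f i ≡ 1ℚ) → prod f ≡ 1ℚ
prod-one {k} f f≡1 = trans (prod-cong-≗ f≡1) (prod-replicate-one k)

prod-zero : ∀ {k} (f : Fin k → ℚ) (a : Fin k) → f a ≡ 0ℚ → prod f ≡ 0ℚ
prod-zero {suc k} f a fa≡0 = trans (prod-remove {i = a} f) (trans (cong (_* prod (f ∘ punchIn a)) fa≡0) (*-zeroˡ (prod (f ∘ punchIn a))))

prod-merge : ∀ {k} {a b : Fin k} → a ≢ b → (f g : Fin k → ℚ) → g a ≡ f a * f b → g b ≡ 1ℚ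
  → (∀ c → c ≢ a → c ≢ b → f c ≡ g c) → prod f ≡ prod g
prod-merge a≢b f g ga gb f≡g = sum-cong-off₂ *-1-commutativeMonoid a≢b f g f≡g
  (sym (trans (cong₂ _*_ ga gb) (*-identityʳ _)))

prod-linear : ∀ {k} (a : Fin k) r s (f f₁ f₂ : Fin k → ℚ) → f a ≡ r * f₁ a + s * f₂ a
  → (∀ c → c ≢ a → f₁ c ≡ f c) → (∀ c → c ≢ a → f₂ c ≡ f c)
  → prod f ≡ r * prod f₁ + s * prod f₂
prod-linear {suc k} a r s f f₁ f₂ fa f₁≡f f₂≡f = begin
  prod f                                         ≡⟨ prod-remove {i = a} f ⟩
  f a * R f                                      ≡⟨ cong (_* R f) fa ⟩
  (r * f₁ a + s * f₂ a) * R f                    ≡⟨ distrib r s (f₁ a) (f₂ a) (R f) ⟩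
  r * (f₁ a * R f) + s * (f₂ a * R f)            ≡⟨ cong₂ (λ x y → r * (f₁ a * x) + s * (f₂ a * y)) (rest f₁≡f) (rest f₂≡f) ⟩
  r * (f₁ a * R f₁) + s * (f₂ a * R f₂)          ≡⟨ sym (cong₂ (λ x y → r * x + s * y) (prod-remove {i = a} f₁) (prod-remove {i = a} f₂)) ⟩
  r * prod f₁ + s * prod f₂                      ∎
  where
  open ≡-Reasoning
  R : (Fin (suc k) → ℚ) → ℚ
  R h = prod (h ∘ punchIn a)
  rest : ∀ {h} → (∀ c → c ≢ a → h c ≡ f c) → R f ≡ R h
  rest h≡f = prod-cong-≗ (λ c → sym (h≡f _ (punchInᵢ≢i a c)))
  distrib : ∀ r s x y z → (r * x + s * y) * z ≡ r * (x * z) + s * (y * z)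
  distrib = solve-∀ ℚ-ring

infix 4 _==_

-- The same test as the one used in Defs for colour classes and part contents.
_==_ : ∀ {k} → Fin k → Fin k → Bool
u == v = ⌊ u ≟ v ⌋

==-refl : ∀ {k} (a : Fin k) → (a == a) ≡ true
==-refl a with a ≟ a
... | yes _   = refl
... | no a≢a = ⊥-elim (a≢a refl)

==-≢ : ∀ {k} {a b : Fin k} → a ≢ b → (a == b) ≡ false
==-≢ {a = a} {b} a≢b with a ≟ b
... | yes a≡b = ⊥-elim (a≢b a≡b)
... | no _    = refl

==-sound : ∀ {k} {a b : Fin k} → (a == b) ≡ true → a ≡ b
==-sound {a = a} {b} eq with a ≟ b
... | yes a≡b = a≡b

infixl 6 _[_]≔_

_[_]≔_ : ∀ {k} {A : Set} → (Fin k → A) → Fin k → A → Fin k → A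
f [ a ]≔ x = updateAt f a (const x)

[]≔-updates : ∀ {k} {A : Set} (f : Fin k → A) a {x} → (f [ a ]≔ x) a ≡ x
[]≔-updates f a = updateAt-updates a f

[]≔-minimal : ∀ {k} {A : Set} (f : Fin k → A) {a c x} → c ≢ a → (f [ a ]≔ x) c ≡ f c
[]≔-minimal f {a} {c} c≢a = updateAt-minimal c a f c≢a

[]≔₂-minimal : ∀ {k} {A : Set} (f : Fin k → A) {a b c x y} → c ≢ a → c ≢ b → (f [ a ]≔ x [ b ]≔ y) c ≡ f c
[]≔₂-minimal f {a} c≢a c≢b = trans ([]≔-minimal (f [ a ]≔ _) c≢b) ([]≔-minimal f c≢a)

ofSize : ∀ {m} → ℕ → Subset m → ℚ
ofSize j U = 𝟙 (∣ U ∣ ≡ᵇ j)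

δ : ∀ {m} → Subset m → ℚ
δ = ofSize 0

infixl 7 _⊛_

-- (u ⊛ v) U is the sum of u V * v (U ∖ V) over all V ⊆ U.
_⊛_ : ∀ {m} → (Subset m → ℚ) → (Subset m → ℚ) → Subset m → ℚ
_⊛_ {zero}  u v [] = u [] * v []
_⊛_ {suc m} u v (false ∷ U) = (u ∘ (false ∷_) ⊛ v ∘ (false ∷_)) U
_⊛_ {suc m} u v (true ∷ U)  = (u ∘ (true ∷_) ⊛ v ∘ (false ∷_)) U + (u ∘ (false ∷_) ⊛ v ∘ (true ∷_)) U

⊛-cong : ∀ {m} {u u′ v v′ : Subset m → ℚ} → u ≗ u′ → v ≗ v′ → u ⊛ v ≗ u′ ⊛ v′
⊛-cong u≗u′ v≗v′ []          = cong₂ _*_ (u≗u′ []) (v≗v′ [])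
⊛-cong u≗u′ v≗v′ (false ∷ U) = ⊛-cong (u≗u′ ∘ (false ∷_)) (v≗v′ ∘ (false ∷_)) U
⊛-cong u≗u′ v≗v′ (true ∷ U)  = cong₂ _+_ (⊛-cong (u≗u′ ∘ (true ∷_)) (v≗v′ ∘ (false ∷_)) U)
                                          (⊛-cong (u≗u′ ∘ (false ∷_)) (v≗v′ ∘ (true ∷_)) U)

⊛-zeroˡ : ∀ {m} (u v : Subset m → ℚ) → (∀ U → u U ≡ 0ℚ) → ∀ U → (u ⊛ v) U ≡ 0ℚ
⊛-zeroˡ u v u≡0 []          = trans (cong (_* v []) (u≡0 [])) (*-zeroˡ (v []))
⊛-zeroˡ u v u≡0 (false ∷ U) = ⊛-zeroˡ _ _ (u≡0 ∘ (false ∷_)) U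
⊛-zeroˡ u v u≡0 (true ∷ U)  = cong₂ _+_ (⊛-zeroˡ _ _ (u≡0 ∘ (true ∷_)) U) (⊛-zeroˡ _ _ (u≡0 ∘ (false ∷_)) U)

⊛-zeroʳ : ∀ {m} (u v : Subset m → ℚ) → (∀ U → v U ≡ 0ℚ) → ∀ U → (u ⊛ v) U ≡ 0ℚ
⊛-zeroʳ u v v≡0 []          = trans (cong (u [] *_) (v≡0 [])) (*-zeroʳ (u []))
⊛-zeroʳ u v v≡0 (false ∷ U) = ⊛-zeroʳ _ _ (v≡0 ∘ (false ∷_)) U
⊛-zeroʳ u v v≡0 (true ∷ U)  = cong₂ _+_ (⊛-zeroʳ _ _ (v≡0 ∘ (false ∷_)) U) (⊛-zeroʳ _ _ (v≡0 ∘ (true ∷_)) U)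

⊛-identityʳ : ∀ {m} (u : Subset m → ℚ) → u ⊛ δ ≗ u
⊛-identityʳ u []          = *-identityʳ (u [])
⊛-identityʳ u (false ∷ U) = ⊛-identityʳ (u ∘ (false ∷_)) U
⊛-identityʳ u (true ∷ U)  = trans (cong₂ _+_ (⊛-identityʳ (u ∘ (true ∷_)) U) (⊛-zeroʳ _ _ (λ _ → refl) U))
                                  (+-identityʳ _)

⊛-identityˡ : ∀ {m} (u : Subset m → ℚ) → δ ⊛ u ≗ u
⊛-identityˡ u []          = *-identityˡ (u [])
⊛-identityˡ u (false ∷ U) = ⊛-identityˡ (u ∘ (false ∷_)) U
⊛-identityˡ u (true ∷ U)  = trans (cong₂ _+_ (⊛-zeroˡ _ _ (λ _ → refl) U) (⊛-identityˡ (u ∘ (true ∷_)) U))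
                                  (+-identityˡ _)

Weights : ℕ → ℕ → Set
Weights k m = Fin k → Subset m → ℚ

colour₀ : ∀ {k m} → Fin k → Weights k (suc m) → Weights k m
colour₀ c₀ w c U = w c ((c₀ == c) ∷ U)

colour₀-≡ : ∀ {k m} (w : Weights k (suc m)) c → colour₀ c w c ≗ w c ∘ (true ∷_)
colour₀-≡ w c U = cong (λ x → w c (x ∷ U)) (==-refl c)

colour₀-≢ : ∀ {k m} (w : Weights k (suc m)) {c₀ c} → c₀ ≢ c → colour₀ c₀ w c ≗ w c ∘ (false ∷_)
colour₀-≢ w {c = c} c₀≢c U = cong (λ x → w c (x ∷ U)) (==-≢ c₀≢c)

-- Z m w is the sum, over all colourings ψ : Fin m → Fin k, of ∏_c w c (ψ⁻¹ c);
-- the recursion chooses the colour c₀ of the element 0.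
Z : ∀ {k} m → Weights k m → ℚ
Z zero    w = prod (λ c → w c [])
Z (suc m) w = sum (λ c₀ → Z m (colour₀ c₀ w))

Z-cong : ∀ {k} m {w w′ : Weights k m} → (∀ c → w c ≗ w′ c) → Z m w ≡ Z m w′
Z-cong zero    w≗w′ = prod-cong-≗ (λ c → w≗w′ c [])
Z-cong {k} (suc m) w≗w′ = sum-cong-≗ {k} (λ c₀ → Z-cong m (λ c U → w≗w′ c _))

Z-linear : ∀ {k} m (a : Fin k) r s (w w₁ w₂ : Weights k m)
  → (∀ U → w a U ≡ r * w₁ a U + s * w₂ a U)
  → (∀ c → c ≢ a → w₁ c ≗ w c) → (∀ c → c ≢ a → w₂ c ≗ w c)
  → Z m w ≡ r * Z m w₁ + s * Z m w₂
Z-linear zero a r s w w₁ w₂ wa w₁≗w w₂≗w =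
  prod-linear a r s _ _ _ (wa []) (λ c c≢a → w₁≗w c c≢a []) (λ c c≢a → w₂≗w c c≢a [])
Z-linear (suc m) a r s w w₁ w₂ wa w₁≗w w₂≗w = trans
  (sum-cong-≗ (λ c₀ → Z-linear m a r s (colour₀ c₀ w) (colour₀ c₀ w₁) (colour₀ c₀ w₂)
                 (λ U → wa _) (λ c c≢a U → w₁≗w c c≢a _) (λ c c≢a U → w₂≗w c c≢a _)))
  (sum-linear r s (λ c₀ → Z m (colour₀ c₀ w₁)) (λ c₀ → Z m (colour₀ c₀ w₂)))

Z-scale : ∀ {k} m (a : Fin k) r (w w₁ : Weights k m)
  → (∀ U → w a U ≡ r * w₁ a U) → (∀ c → c ≢ a → w₁ c ≗ w c)
  → Z m w ≡ r * Z m w₁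
Z-scale m a r w w₁ wa w₁≗w = begin
  Z m w                            ≡⟨ Z-linear m a r 0ℚ w w₁ w₁ (λ U → trans (wa U) (plus0 r (w₁ a U))) w₁≗w w₁≗w ⟩
  r * Z m w₁ + 0ℚ * Z m w₁         ≡⟨ sym (plus0 r (Z m w₁)) ⟩
  r * Z m w₁                       ∎
  where
  open ≡-Reasoning
  plus0 : ∀ r x → r * x ≡ r * x + 0ℚ * x
  plus0 = solve-∀ ℚ-ring

Z-zero : ∀ {k} m (a : Fin k) (w : Weights k m) → (∀ U → w a U ≡ 0ℚ) → Z m w ≡ 0ℚ
Z-zero zero    a w wa≡0 = prod-zero _ a (wa≡0 [])
Z-zero (suc m) a w wa≡0 = sum-zero _ (λ c₀ → Z-zero m a (colour₀ c₀ w) (λ U → wa≡0 _))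

Z-merge : ∀ {k} m {a b : Fin k} → a ≢ b → (w w′ : Weights k m)
  → w′ a ≗ w a ⊛ w b → w′ b ≗ δ → (∀ c → c ≢ a → c ≢ b → w′ c ≗ w c)
  → Z m w ≡ Z m w′
Z-merge zero a≢b w w′ w′a w′b w′c =
  prod-merge a≢b _ _ (w′a []) (w′b []) (λ c c≢a c≢b → sym (w′c c c≢a c≢b []))
Z-merge {k} (suc m) {a} {b} a≢b w w′ w′a w′b w′c =
  sum-cong-off₂ +-0-commutativeMonoid a≢b (λ c₀ → Z m (colour₀ c₀ w)) (λ c₀ → Z m (colour₀ c₀ w′))
    elsewhere at-a-and-b
  where
  open ≡-Reasoning
  b≢a : b ≢ a
  b≢a = ≢-sym a≢b

  unit₂ : ∀ x y → 1ℚ * x + 1ℚ * y ≡ x + y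
  unit₂ x y = cong₂ _+_ (*-identityˡ x) (*-identityˡ y)

  elsewhere : ∀ c₀ → c₀ ≢ a → c₀ ≢ b → Z m (colour₀ c₀ w) ≡ Z m (colour₀ c₀ w′)
  elsewhere c₀ c₀≢a c₀≢b = Z-merge m a≢b (colour₀ c₀ w) (colour₀ c₀ w′)
    (λ U → begin
      colour₀ c₀ w′ a U                          ≡⟨ colour₀-≢ w′ c₀≢a U ⟩
      w′ a (false ∷ U)                           ≡⟨ w′a _ ⟩
      (w a ∘ (false ∷_) ⊛ w b ∘ (false ∷_)) U    ≡⟨ ⊛-cong (sym ∘ colour₀-≢ w c₀≢a) (sym ∘ colour₀-≢ w c₀≢b) U ⟩
      (colour₀ c₀ w a ⊛ colour₀ c₀ w b) U        ∎)
    (λ U → trans (colour₀-≢ w′ c₀≢b U) (w′b _))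
    (λ c c≢a c≢b U → w′c c c≢a c≢b _)

  -- (w a ⊛ w b) (true ∷ U) = C₁ U + C₂ U according to the factor receiving the element 0.
  C₁ C₂ : Subset m → ℚ
  C₁ = w a ∘ (true ∷_) ⊛ w b ∘ (false ∷_)
  C₂ = w a ∘ (false ∷_) ⊛ w b ∘ (true ∷_)

  v : (Subset m → ℚ) → Weights k m
  v C = colour₀ a w′ [ a ]≔ C

  v-a : ∀ C → v C a ≗ C
  v-a C U = cong (λ f → f U) ([]≔-updates (colour₀ a w′) a)

  v-off-a : ∀ C c → c ≢ a → v C c ≗ w′ c ∘ (false ∷_)
  v-off-a C c c≢a U = trans (cong (λ f → f U) ([]≔-minimal (colour₀ a w′) c≢a)) (colour₀-≢ w′ (≢-sym c≢a) U)

  v-b : ∀ C → v C b ≗ δ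
  v-b C U = trans (v-off-a C b b≢a U) (w′b _)

  merge-a : Z m (colour₀ a w) ≡ Z m (v C₁)
  merge-a = Z-merge m a≢b (colour₀ a w) (v C₁)
    (λ U → trans (v-a C₁ U) (⊛-cong (sym ∘ colour₀-≡ w a) (sym ∘ colour₀-≢ w a≢b) U))
    (v-b C₁)
    (λ c c≢a c≢b U → trans (v-off-a C₁ c c≢a U) (trans (w′c c c≢a c≢b _) (sym (colour₀-≢ w (≢-sym c≢a) U))))

  merge-b : Z m (colour₀ b w) ≡ Z m (v C₂)
  merge-b = Z-merge m a≢b (colour₀ b w) (v C₂)
    (λ U → trans (v-a C₂ U) (⊛-cong (sym ∘ colour₀-≢ w b≢a) (sym ∘ colour₀-≡ w b) U))
    (v-b C₂)
    (λ c c≢a c≢b U → trans (v-off-a C₂ c c≢a U) (trans (w′c c c≢a c≢b _) (sym (colour₀-≢ w (≢-sym c≢b) U))))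

  split-a : Z m (colour₀ a w′) ≡ Z m (v C₁) + Z m (v C₂)
  split-a = begin
    Z m (colour₀ a w′)                    ≡⟨ Z-linear m a 1ℚ 1ℚ (colour₀ a w′) (v C₁) (v C₂) split-weight
                                               (λ c c≢a U → trans (v-off-a C₁ c c≢a U) (sym (colour₀-≢ w′ (≢-sym c≢a) U)))
                                               (λ c c≢a U → trans (v-off-a C₂ c c≢a U) (sym (colour₀-≢ w′ (≢-sym c≢a) U))) ⟩
    1ℚ * Z m (v C₁) + 1ℚ * Z m (v C₂)     ≡⟨ unit₂ (Z m (v C₁)) (Z m (v C₂)) ⟩
    Z m (v C₁) + Z m (v C₂)               ∎
    where
    split-weight : ∀ U → colour₀ a w′ a U ≡ 1ℚ * v C₁ a U + 1ℚ * v C₂ a U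
    split-weight U = begin
      colour₀ a w′ a U                  ≡⟨ trans (colour₀-≡ w′ a U) (w′a _) ⟩
      C₁ U + C₂ U                       ≡⟨ sym (unit₂ (C₁ U) (C₂ U)) ⟩
      1ℚ * C₁ U + 1ℚ * C₂ U             ≡⟨ sym (cong₂ (λ x y → 1ℚ * x + 1ℚ * y) (v-a C₁ U) (v-a C₂ U)) ⟩
      1ℚ * v C₁ a U + 1ℚ * v C₂ a U     ∎

  vanish-b : Z m (colour₀ b w′) ≡ 0ℚ
  vanish-b = Z-zero m b _ (λ U → trans (colour₀-≡ w′ b U) (w′b _))

  at-a-and-b : Z m (colour₀ a w) + Z m (colour₀ b w) ≡ Z m (colour₀ a w′) + Z m (colour₀ b w′)
  at-a-and-b = begin
    Z m (colour₀ a w) + Z m (colour₀ b w)     ≡⟨ cong₂ _+_ merge-a merge-b ⟩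
    Z m (v C₁) + Z m (v C₂)                   ≡⟨ sym split-a ⟩
    Z m (colour₀ a w′)                        ≡⟨ sym (+-identityʳ _) ⟩
    Z m (colour₀ a w′) + 0ℚ                   ≡⟨ cong (Z m (colour₀ a w′) +_) (sym vanish-b) ⟩
    Z m (colour₀ a w′) + Z m (colour₀ b w′)   ∎

preimage : ∀ {m k} → (Fin m → Fin k) → Fin k → Subset m
preimage ψ c = vtabulate (λ i → ψ i == c)

ℕtoℚ-countᵇ-concatMap : ∀ {k} {A B : Set} (H : Fin k → B → A) (q : A → Bool) (L : List B)
  → ℕtoℚ (countᵇ q (concatMap (λ f → map (λ c → H c f) (allFin k)) L))
    ≡ sum (λ c → ℕtoℚ (countᵇ (q ∘ H c) L))
ℕtoℚ-countᵇ-concatMap {k} H q []      = sym (sum-replicate-zero k)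
ℕtoℚ-countᵇ-concatMap {k} {A} H q (f ∷ L) = begin
  ℕtoℚ (countᵇ q (map (λ c → H c f) (allFin k) ++ rest))
    ≡⟨ trans (cong ℕtoℚ (countᵇ-++ q this rest)) (ℕtoℚ-+ (countᵇ q this) (countᵇ q rest)) ⟩
  ℕtoℚ (countᵇ q (map (λ c → H c f) (allFin k))) + ℕtoℚ (countᵇ q rest)
    ≡⟨ cong₂ _+_ (trans (cong (ℕtoℚ ∘ countᵇ q) (map-tabulate id (λ c → H c f))) (ℕtoℚ-countᵇ-tabulate q (λ c → H c f)))
                 (ℕtoℚ-countᵇ-concatMap H q L) ⟩
  sum (λ c → 𝟙 (q (H c f))) + sum (λ c → ℕtoℚ (countᵇ (q ∘ H c) L))
    ≡⟨ sym (∑-distrib-+ (λ c → 𝟙 (q (H c f))) (λ c → ℕtoℚ (countᵇ (q ∘ H c) L))) ⟩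
  sum (λ c → 𝟙 (q (H c f)) + ℕtoℚ (countᵇ (q ∘ H c) L))
    ≡⟨ sum-cong-≗ {k} (λ c → sym (ℕtoℚ-countᵇ-∷ (q ∘ H c) f L)) ⟩
  sum (λ c → ℕtoℚ (countᵇ (q ∘ H c) (f ∷ L)))   ∎
  where
  open ≡-Reasoning
  this rest : List A
  this = map (λ c → H c f) (allFin k)
  rest = concatMap (λ f → map (λ c → H c f) (allFin k)) L

ℕtoℚ-countᵇ-allFuns : ∀ {k} m (q : (Fin m → Fin k) → Bool) (w : Weights k m)
  → (∀ ψ → 𝟙 (q ψ) ≡ prod (λ c → w c (preimage ψ c)))
  → ℕtoℚ (countᵇ q (allFuns m k)) ≡ Z m w
ℕtoℚ-countᵇ-allFuns zero q w q≡∏ =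
  trans (ℕtoℚ-countᵇ-∷ q _ []) (trans (+-identityʳ _) (q≡∏ _))
ℕtoℚ-countᵇ-allFuns {k} (suc m) q w q≡∏ =
  trans (ℕtoℚ-countᵇ-concatMap _ q (allFuns m k))
        (sum-cong-≗ {k} (λ c → ℕtoℚ-countᵇ-allFuns m _ (colour₀ c w) (λ ψ → q≡∏ _)))

Pairs : ℕ → Set
Pairs k = List (Fin k × Fin k)

isFirst : ∀ {k} → Pairs k → Fin k → Bool
isFirst []            c = false
isFirst ((a , b) ∷ P) c = (c == a) ∨ isFirst P c

split : ∀ {k} → Pairs k → (Exp k → ℚ) → Exp k → ℚ
split []            h α = h α
split ((a , b) ∷ P) h α = ½ * split P h (α [ a ]≔ 1 [ b ]≔ 1) - split P h α

split-cong : ∀ {k} (P : Pairs k) {h h′ : Exp k → ℚ} → h ≗ h′ → split P h ≗ split P h′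
split-cong []            h≗h′ α = h≗h′ α
split-cong ((a , b) ∷ P) h≗h′ α = cong₂ (λ x y → ½ * x - y) (split-cong P h≗h′ _) (split-cong P h≗h′ α)

split-linear : ∀ {k} (P : Pairs k) q (h₁ h₂ : Exp k → ℚ) α
  → split P (λ β → q * h₁ β + h₂ β) α ≡ q * split P h₁ α + split P h₂ α
split-linear []            q h₁ h₂ α = refl
split-linear ((a , b) ∷ P) q h₁ h₂ α =
  trans (cong₂ (λ x y → ½ * x - y) (split-linear P q h₁ h₂ _) (split-linear P q h₁ h₂ α))
        (linear q _ _ _ _)
  where
  linear : ∀ q a b c d → ½ * (q * a + b) - (q * c + d) ≡ q * (½ * a - c) + (½ * b - d)
  linear = solve-∀ ℚ-ring

split-zero : ∀ {k} (P : Pairs k) α → split P (λ _ → 0ℚ) α ≡ 0ℚ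
split-zero []            α = refl
split-zero ((a , b) ∷ P) α = cong₂ (λ x y → ½ * x - y) (split-zero P _) (split-zero P α)

split-eval : ∀ {n} (P : Pairs n) (b : List ℕ → Poly n) E α
  → split P (eval b E) α ≡ eval (λ l → split P (b l)) E α
split-eval P b []            α = split-zero P α
split-eval P b ((q , l) ∷ E) α =
  trans (split-linear P q (b l) (eval b E) α) (cong (q * split P (b l) α +_) (split-eval P b E α))

-- Merging the colour b into a turns both terms into weighted colourings that differ only
-- at a, where Z is linear.
Z-split-pair : ∀ {k} m {a b : Fin k} → a ≢ b → (u v : Subset m → ℚ) (W W₁ W₂ : Weights k m)
  → W₁ a ≗ u → W₁ b ≗ u → W₂ a ≗ v → W₂ b ≗ δ
  → W a ≗ (λ U → ½ * (u ⊛ u) U - v U) → W b ≗ δ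
  → (∀ c → c ≢ a → c ≢ b → W₁ c ≗ W c) → (∀ c → c ≢ a → c ≢ b → W₂ c ≗ W c)
  → ½ * Z m W₁ - Z m W₂ ≡ Z m W
Z-split-pair {k} m {a} {b} a≢b u v W W₁ W₂ W₁a W₁b W₂a W₂b Wa Wb W₁c W₂c = begin
  ½ * Z m W₁ - Z m W₂                    ≡⟨ cong₂ (λ x y → ½ * x - y) merge₁ merge₂ ⟩
  ½ * Z m W₁′ - Z m W₂′                  ≡⟨ minus (Z m W₁′) (Z m W₂′) ⟩
  ½ * Z m W₁′ + (- 1ℚ) * Z m W₂′         ≡⟨ sym (Z-linear m a ½ (- 1ℚ) W W₁′ W₂′ at-a (λ c → off-a) (λ c → off-a)) ⟩
  Z m W                                  ∎
  where
  open ≡-Reasoning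
  W₁′ W₂′ : Weights k m
  W₁′ = W [ a ]≔ u ⊛ u
  W₂′ = W [ a ]≔ v

  off-a : ∀ {C c} → c ≢ a → (W [ a ]≔ C) c ≗ W c
  off-a c≢a U = cong (λ f → f U) ([]≔-minimal W c≢a)

  at-b : ∀ {C} → (W [ a ]≔ C) b ≗ δ
  at-b U = trans (off-a (≢-sym a≢b) U) (Wb U)

  merge₁ : Z m W₁ ≡ Z m W₁′
  merge₁ = Z-merge m a≢b W₁ W₁′
    (λ U → trans (cong (λ f → f U) ([]≔-updates W a)) (⊛-cong (sym ∘ W₁a) (sym ∘ W₁b) U))
    at-b (λ c c≢a c≢b U → trans (off-a c≢a U) (sym (W₁c c c≢a c≢b U)))

  merge₂ : Z m W₂ ≡ Z m W₂′
  merge₂ = Z-merge m a≢b W₂ W₂′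
    (λ U → trans (cong (λ f → f U) ([]≔-updates W a))
                 (trans (sym (⊛-identityʳ v U)) (⊛-cong (sym ∘ W₂a) (sym ∘ W₂b) U)))
    at-b (λ c c≢a c≢b U → trans (off-a c≢a U) (sym (W₂c c c≢a c≢b U)))

  minus : ∀ x y → ½ * x - y ≡ ½ * x + (- 1ℚ) * y
  minus = solve-∀ ℚ-ring

  at-a : ∀ U → W a U ≡ ½ * W₁′ a U + (- 1ℚ) * W₂′ a U
  at-a U = trans (Wa U) (trans (minus ((u ⊛ u) U) (v U))
    (sym (cong₂ (λ x y → ½ * x + (- 1ℚ) * y) (cong (λ f → f U) ([]≔-updates W a)) (cong (λ f → f U) ([]≔-updates W a)))))

TwoZero : ∀ {k} → Exp k → Fin k × Fin k → Set
TwoZero α (a , b) = α a ≡ 2 × α b ≡ 0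

Apart : ∀ {k} → Fin k × Fin k → Fin k × Fin k → Set
Apart (a , b) (a′ , b′) = a ≢ a′ × b ≢ b′

Matching : ∀ {k} → Exp k → Pairs k → Set
Matching α P = All (TwoZero α) P × AllPairs Apart P

2≢0-positions : ∀ {k} {α : Exp k} {c d} → α c ≡ 2 → α d ≡ 0 → c ≢ d
2≢0-positions αc αd refl with trans (sym αc) αd
... | ()

isFirst-avoid : ∀ {k} (P : Pairs k) {c} → All (λ q → c ≢ proj₁ q) P → isFirst P c ≡ false
isFirst-avoid []            []            = refl
isFirst-avoid ((a , b) ∷ P) (c≢a ∷ avoid) = trans (cong (_∨ isFirst P _) (==-≢ c≢a)) (isFirst-avoid P avoid)

isFirst-≢2 : ∀ {k} {α : Exp k} (P : Pairs k) {c} → All (TwoZero α) P → α c ≢ 2 → isFirst P c ≡ false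
isFirst-≢2 {α = α} P vals αc≢2 = isFirst-avoid P (All.map (λ {q} tz c≡a → αc≢2 (trans (cong α c≡a) (proj₁ tz))) vals)

TwoZero-update : ∀ {k} {α : Exp k} {a b} (P : Pairs k) → α a ≡ 2 → α b ≡ 0
  → All (Apart (a , b)) P → All (TwoZero α) P → All (TwoZero (α [ a ]≔ 1 [ b ]≔ 1)) P
TwoZero-update {α = α} {a} {b} P αa αb avoid vals = All.zipWith update (avoid , vals)
  where
  update : ∀ {q} → Apart (a , b) q × TwoZero α q → TwoZero (α [ a ]≔ 1 [ b ]≔ 1) q
  update ((a≢a′ , b≢b′) , (αa′ , αb′)) =
      trans ([]≔₂-minimal α (≢-sym a≢a′) (2≢0-positions αa′ αb)) αa′
    , trans ([]≔₂-minimal α (≢-sym (2≢0-positions αa αb′)) (≢-sym b≢b′)) αb′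

splitWeight : ∀ {m} → (ℕ → Subset m → ℚ) → Subset m → ℚ
splitWeight g U = ½ * (g 1 ⊛ g 1) U - g 2 U

splitWeights : ∀ {k m} → (ℕ → Subset m → ℚ) → Pairs k → Exp k → Weights k m
splitWeights g P α c U = if isFirst P c then splitWeight g U else g (α c) U

module _ {m} (g : ℕ → Subset m → ℚ) (g₀≗δ : g 0 ≗ δ) where

  split-Z : ∀ {k} (P : Pairs k) α → Matching α P
    → split P (λ β → Z m (g ∘ β)) α ≡ Z m (splitWeights g P α)
  split-Z []            α _ = refl
  split-Z ((a , b) ∷ P) α ((αa , αb) ∷ vals , avoid ∷ apart) = begin
    ½ * split P (λ β → Z m (g ∘ β)) α′ - split P (λ β → Z m (g ∘ β)) α
      ≡⟨ cong₂ (λ x y → ½ * x - y) (split-Z P α′ (vals′ , apart)) (split-Z P α (vals , apart)) ⟩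
    ½ * Z m (splitWeights g P α′) - Z m (splitWeights g P α)
      ≡⟨ Z-split-pair m a≢b (g 1) (g 2) _ _ _
           (at-a α′ α′a) (at-b α′ α′b) (at-a α αa) (λ U → trans (at-b α αb U) (g₀≗δ U))
           (λ U → cong (λ x → if x ∨ isFirst P a then splitWeight g U else g (α a) U) (==-refl a))
           (λ U → trans (cong (λ x → if x ∨ isFirst P b then splitWeight g U else g (α b) U) (==-≢ b≢a))
                        (trans (at-b α αb U) (g₀≗δ U)))
           (λ c c≢a c≢b U → trans (cong (λ j → if isFirst P c then splitWeight g U else g j U) ([]≔₂-minimal α c≢a c≢b))
                                  (sym (off-a c≢a U)))
           (λ c c≢a c≢b U → sym (off-a c≢a U)) ⟩
    Z m (splitWeights g ((a , b) ∷ P) α)  ∎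
    where
    open ≡-Reasoning
    α′ : Exp _
    α′ = α [ a ]≔ 1 [ b ]≔ 1
    a≢b : a ≢ b
    a≢b = 2≢0-positions αa αb
    b≢a : b ≢ a
    b≢a = ≢-sym a≢b
    α′a : α′ a ≡ 1
    α′a = trans ([]≔-minimal (α [ a ]≔ 1) a≢b) ([]≔-updates α a)
    α′b : α′ b ≡ 1
    α′b = []≔-updates (α [ a ]≔ 1) b
    vals′ : All (TwoZero α′) P
    vals′ = TwoZero-update P αa αb avoid vals
    notFirst-a : isFirst P a ≡ false
    notFirst-a = isFirst-avoid P (All.map proj₁ avoid)
    notFirst-b : isFirst P b ≡ false
    notFirst-b = isFirst-≢2 P vals (λ αb≡2 → 2≢0-positions {α = α} αb≡2 αb refl)
    at-a : ∀ β {j} → β a ≡ j → splitWeights g P β a ≗ g j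
    at-a β βa U = cong₂ (λ x j → if x then splitWeight g U else g j U) notFirst-a βa
    at-b : ∀ β {j} → β b ≡ j → splitWeights g P β b ≗ g j
    at-b β βb U = cong₂ (λ x j → if x then splitWeight g U else g j U) notFirst-b βb
    off-a : ∀ {c} → c ≢ a → splitWeights g ((a , b) ∷ P) α c ≗ splitWeights g P α c
    off-a {c} c≢a U = cong (λ x → if x ∨ isFirst P c then splitWeight g U else g (α c) U) (==-≢ c≢a)

partSum : (l : List ℕ) → Subset (length l) → ℕ
partSum []      []      = 0
partSum (x ∷ l) (b ∷ U) = (if b then x else 0) ℕ.+ partSum l U

pWeight : (l : List ℕ) → ℕ → Subset (length l) → ℚ
pWeight l j U = 𝟙 (partSum l U ≡ᵇ j)

partContent≡partSum : ∀ {k} l (ψ : Fin (length l) → Fin k) c → partContent l ψ c ≡ partSum l (preimage ψ c)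
partContent≡partSum []      ψ c = refl
partContent≡partSum (x ∷ l) ψ c = cong ((if ψ zero == c then x else 0) ℕ.+_) (partContent≡partSum l (ψ ∘ suc) c)

p≡Z : ∀ {k} l (α : Exp k) → p l α ≡ Z (length l) (λ c → pWeight l (α c))
p≡Z {k} l α = ℕtoℚ-countᵇ-allFuns (length l) _ _ (λ ψ →
  trans (𝟙-allB-tabulate (λ c → partContent l ψ c ≡ᵇ α c) id)
        (prod-cong-≗ {k} (λ c → cong (λ s → 𝟙 (s ≡ᵇ α c)) (partContent≡partSum l ψ c))))

Positive : List ℕ → Set
Positive = All (1 ≤_)

singleTwo : (l : List ℕ) → Subset (length l) → ℚ
singleTwo l U = 𝟙 ((∣ U ∣ ≡ᵇ 1) ∧ (partSum l U ≡ᵇ 2))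

pWeight-0 : ∀ {l} → Positive l → pWeight l 0 ≗ δ
pWeight-0 []                  []          = refl
pWeight-0 (s≤s z≤n ∷ _)       (true ∷ U)  = refl
pWeight-0 (_ ∷ positive)      (false ∷ U) = pWeight-0 positive U

partSum≡0 : ∀ {l} → Positive l → ∀ U → (partSum l U ≡ᵇ 0) ≡ (∣ U ∣ ≡ᵇ 0)
partSum≡0 []                  []          = refl
partSum≡0 (s≤s z≤n ∷ _)       (true ∷ U)  = refl
partSum≡0 (_ ∷ positive)      (false ∷ U) = partSum≡0 positive U

empty-partSum : ∀ l U k → ((∣ U ∣ ≡ᵇ 0) ∧ (partSum l U ≡ᵇ suc k)) ≡ false
empty-partSum []      []          k = refl
empty-partSum (x ∷ l) (true ∷ U)  k = refl
empty-partSum (x ∷ l) (false ∷ U) k = empty-partSum l U k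

-- Every set of two parts equal to 1 is met twice in the convolution.
pWeight-1⊛1 : ∀ {l} → Positive l → ∀ U → ½ * (pWeight l 1 ⊛ pWeight l 1) U ≡ pWeight l 2 U - singleTwo l U
pWeight-1⊛1 []                             []          = refl
pWeight-1⊛1 (_ ∷ positive)                 (false ∷ U) = pWeight-1⊛1 positive U
pWeight-1⊛1 {suc zero ∷ l} (_ ∷ positive)   (true ∷ U)  = begin
  ½ * ((pWeight l 0 ⊛ pWeight l 1) U + (pWeight l 1 ⊛ pWeight l 0) U)
    ≡⟨ cong (λ x → ½ * x) (cong₂ _+_ (trans (⊛-cong (pWeight-0 positive) (λ _ → refl) U) (⊛-identityˡ _ U))
                                     (trans (⊛-cong (λ _ → refl) (pWeight-0 positive) U) (⊛-identityʳ _ U))) ⟩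
  ½ * (pWeight l 1 U + pWeight l 1 U)   ≡⟨ half-double (pWeight l 1 U) ⟩
  pWeight l 1 U - 0ℚ                    ≡⟨ cong (λ b → pWeight l 1 U - 𝟙 b) (sym (empty-partSum l U 0)) ⟩
  pWeight l 1 U - 𝟙 ((∣ U ∣ ≡ᵇ 0) ∧ (partSum l U ≡ᵇ 1))  ∎
  where
  open ≡-Reasoning
  half-double : ∀ x → ½ * (x + x) ≡ x - 0ℚ
  half-double = solve-∀ ℚ-ring
pWeight-1⊛1 {suc (suc zero) ∷ l} (_ ∷ positive) (true ∷ U) = begin
  ½ * ((pWeight (2 ∷ l) 1 ∘ (true ∷_) ⊛ pWeight l 1) U + (pWeight l 1 ⊛ pWeight (2 ∷ l) 1 ∘ (true ∷_)) U)
    ≡⟨ cong (λ x → ½ * x) (cong₂ _+_ (⊛-zeroˡ _ _ (λ _ → refl) U) (⊛-zeroʳ _ _ (λ _ → refl) U)) ⟩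
  0ℚ                                                        ≡⟨ sym (b-b∧b (∣ U ∣ ≡ᵇ 0)) ⟩
  𝟙 (∣ U ∣ ≡ᵇ 0) - 𝟙 ((∣ U ∣ ≡ᵇ 0) ∧ (∣ U ∣ ≡ᵇ 0))          ≡⟨ cong (λ b → 𝟙 b - 𝟙 ((∣ U ∣ ≡ᵇ 0) ∧ b)) (sym (partSum≡0 positive U)) ⟩
  𝟙 (partSum l U ≡ᵇ 0) - 𝟙 ((∣ U ∣ ≡ᵇ 0) ∧ (partSum l U ≡ᵇ 0))  ∎
  where
  open ≡-Reasoning
  b-b∧b : ∀ b → 𝟙 b - 𝟙 (b ∧ b) ≡ 0ℚ
  b-b∧b true  = refl
  b-b∧b false = refl
pWeight-1⊛1 {suc (suc (suc x)) ∷ l} (_ ∷ positive) (true ∷ U) =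
  trans (cong (λ y → ½ * y) (cong₂ _+_ (⊛-zeroˡ _ _ (λ _ → refl) U) (⊛-zeroʳ _ _ (λ _ → refl) U)))
        (cong (λ b → 0ℚ - 𝟙 b) (sym (∧-zeroʳ (∣ U ∣ ≡ᵇ 0))))

splitWeight-pWeight : ∀ {l} → Positive l → splitWeight (pWeight l) ≗ (λ U → - singleTwo l U)
splitWeight-pWeight {l} positive U = trans (cong (_- pWeight l 2 U) (pWeight-1⊛1 positive U)) (cancel (pWeight l 2 U) (singleTwo l U))
  where
  cancel : ∀ a b → a - b - a ≡ - b
  cancel = solve-∀ ℚ-ring

independent : ∀ {n} → Graph n → Subset n → Bool
independent {n} G U = allB (λ u → allB (λ v → not (adj G u v ∧ (lookup U u ∧ lookup U v))) (allFin n)) (allFin n)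

module _ {n} (G : Graph n) (U : Subset n) where

  independent-sound : independent G U ≡ true → ∀ {u v} → adj G u v ≡ true → lookup U u ≡ true → lookup U v ≡ true → ⊥
  independent-sound indep {u} {v} uv u∈U v∈U
    with allB-tabulate⁻ _ id (allB-tabulate⁻ _ id indep u) v
  ... | no-edge rewrite uv | u∈U | v∈U with no-edge
  ... | ()

  independent-complete : (∀ {u v} → adj G u v ≡ true → lookup U u ≡ true → lookup U v ≡ true → ⊥) → independent G U ≡ true
  independent-complete no-edge = allB-tabulate⁺ _ id (λ u → allB-tabulate⁺ _ id (λ v → no-edge-at u v))
    where
    no-edge-at : ∀ u v → not (adj G u v ∧ (lookup U u ∧ lookup U v)) ≡ true
    no-edge-at u v with adj G u v in uv | lookup U u in u∈U | lookup U v in v∈U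
    ... | false | _     | _     = refl
    ... | true  | false | _     = refl
    ... | true  | true  | false = refl
    ... | true  | true  | true  = ⊥-elim (no-edge uv u∈U v∈U)

module _ {n} (G : Graph n) (κ : Fin n → Fin n) where

  isProper-sound : isProper G κ ≡ true → ∀ {u v} → adj G u v ≡ true → (κ u == κ v) ≡ false
  isProper-sound proper {u} {v} uv with allB-tabulate⁻ _ id (allB-tabulate⁻ _ id proper u) v
  ... | ok rewrite uv with κ u == κ v | ok
  ... | false | _ = refl

  isProper-false : isProper G κ ≡ false → ∃₂ λ u v → adj G u v ≡ true × (κ u == κ v) ≡ true
  isProper-false improper with allB-tabulate-false _ id improper
  ... | u , bad-u with allB-tabulate-false _ id bad-u
  ... | v , bad-uv with adj G u v in uv | κ u == κ v in κuv | bad-uv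
  ... | true | true | _ = u , v , uv , κuv

  ∈-preimage : ∀ c u → lookup (preimage κ c) u ≡ (κ u == c)
  ∈-preimage c u = lookup∘tabulate (λ i → κ i == c) u

  classes-independent : isProper G κ ≡ true → ∀ c → independent G (preimage κ c) ≡ true
  classes-independent proper c = independent-complete G (preimage κ c) λ {u} {v} uv u∈c v∈c → true≢false (begin
    true         ≡⟨ sym (==-refl (κ u)) ⟩
    (κ u == κ u) ≡⟨ cong (κ u ==_) (trans (colour-of u∈c) (sym (colour-of v∈c))) ⟩
    (κ u == κ v) ≡⟨ isProper-sound proper uv ⟩
    false        ∎)
    where
    open ≡-Reasoning
    colour-of : ∀ {u} → lookup (preimage κ c) u ≡ true → κ u ≡ c
    colour-of {u} u∈c = ==-sound (trans (sym (∈-preimage c u)) u∈c)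

  class-dependent : ∀ {u v} → adj G u v ≡ true → (κ u == κ v) ≡ true → independent G (preimage κ (κ u)) ≡ false
  class-dependent {u} {v} uv κuv = ¬-not λ indep → independent-sound G (preimage κ (κ u)) indep uv
    (trans (∈-preimage (κ u) u) (==-refl (κ u)))
    (trans (∈-preimage (κ u) v) (trans (cong (κ v ==_) (==-sound κuv)) (==-refl (κ v))))

  𝟙-isProper : 𝟙 (isProper G κ) ≡ prod (λ c → 𝟙 (independent G (preimage κ c)))
  𝟙-isProper with isProper G κ in proper
  ... | true  = sym (prod-one (λ c → 𝟙 (independent G (preimage κ c))) (cong 𝟙 ∘ classes-independent proper))
  ... | false = let u , v , uv , κuv = isProper-false proper in
    sym (prod-zero (λ c → 𝟙 (independent G (preimage κ c))) (κ u) (cong 𝟙 (class-dependent uv κuv)))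

XWeight : ∀ {n} → Graph n → ℕ → Subset n → ℚ
XWeight G j U = 𝟙 (independent G U) * ofSize j U

X≡Z : ∀ {n} (G : Graph n) (α : Exp n) → X G α ≡ Z n (λ c → XWeight G (α c))
X≡Z {n} G α = ℕtoℚ-countᵇ-allFuns n _ _ λ κ → begin
  𝟙 (isProper G κ ∧ expEq (colourContent κ) α)
    ≡⟨ 𝟙-∧ (isProper G κ) _ ⟩
  𝟙 (isProper G κ) * 𝟙 (expEq (colourContent κ) α)
    ≡⟨ cong₂ _*_ (𝟙-isProper G κ)
                 (trans (𝟙-allB-tabulate (λ c → colourContent κ c ≡ᵇ α c) id)
                        (prod-cong-≗ {n} (λ c → cong (λ s → 𝟙 (s ≡ᵇ α c)) (countᵇ-tabulate (λ v → κ v == c) id)))) ⟩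
  prod (λ c → 𝟙 (independent G (preimage κ c))) * prod (λ c → ofSize (α c) (preimage κ c))
    ≡⟨ sym (prod-distrib-* (λ c → 𝟙 (independent G (preimage κ c))) (λ c → ofSize (α c) (preimage κ c))) ⟩
  prod (λ c → XWeight G (α c) (preimage κ c))   ∎
  where open ≡-Reasoning

∈⇒1≤∣∣ : ∀ {m} (U : Subset m) {u} → lookup U u ≡ true → 1 ≤ ∣ U ∣
∈⇒1≤∣∣ (true ∷ U)  {zero}  _   = s≤s z≤n
∈⇒1≤∣∣ (true ∷ U)  {suc u} _   = s≤s z≤n
∈⇒1≤∣∣ (false ∷ U) {suc u} u∈U = ∈⇒1≤∣∣ U u∈U

∈₂⇒2≤∣∣ : ∀ {m} (U : Subset m) {u v} → u ≢ v → lookup U u ≡ true → lookup U v ≡ true → 2 ≤ ∣ U ∣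
∈₂⇒2≤∣∣ (_ ∷ U)     {zero}  {zero}  u≢v _ _ = ⊥-elim (u≢v refl)
∈₂⇒2≤∣∣ (true ∷ U)  {zero}  {suc v} _ _ v∈U = s≤s (∈⇒1≤∣∣ U v∈U)
∈₂⇒2≤∣∣ (true ∷ U)  {suc u} {zero}  _ u∈U _ = s≤s (∈⇒1≤∣∣ U u∈U)
∈₂⇒2≤∣∣ (x ∷ U)     {suc u} {suc v} u≢v u∈U v∈U =
  ℕ.≤-trans (∈₂⇒2≤∣∣ U (u≢v ∘ cong suc) u∈U v∈U) (∣p∣≤∣x∷p∣ x U)

∣∣≡0⇒∉ : ∀ {m} (U : Subset m) → ∣ U ∣ ≡ 0 → ∀ z → lookup U z ≡ false
∣∣≡0⇒∉ (false ∷ U) empty zero    = refl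
∣∣≡0⇒∉ (false ∷ U) empty (suc z) = ∣∣≡0⇒∉ U empty z

∣∣≡1⇒singleton : ∀ {m} (U : Subset m) → ∣ U ∣ ≡ 1
  → ∃ λ x → lookup U x ≡ true × (∀ z → lookup U z ≡ true → z ≡ x)
∣∣≡1⇒singleton (true ∷ U) one = zero , refl , only
  where
  only : ∀ z → lookup (true ∷ U) z ≡ true → z ≡ zero
  only zero    _   = refl
  only (suc z) z∈U with trans (sym z∈U) (∣∣≡0⇒∉ U (ℕ.suc-injective one) z)
  ... | ()
∣∣≡1⇒singleton (false ∷ U) one =
  let x , x∈U , only = ∣∣≡1⇒singleton U one
  in suc x , x∈U , λ { (suc z) z∈U → cong suc (only z z∈U) }

∣∣≡2⇒pair : ∀ {m} (U : Subset m) → ∣ U ∣ ≡ 2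
  → ∃₂ λ x y → x ≢ y × lookup U x ≡ true × lookup U y ≡ true × (∀ z → lookup U z ≡ true → z ≡ x ⊎ z ≡ y)
∣∣≡2⇒pair (true ∷ U) two =
  let y , y∈U , only = ∣∣≡1⇒singleton U (ℕ.suc-injective two)
  in zero , suc y , (λ ()) , refl , y∈U , λ { zero _ → inj₁ refl ; (suc z) z∈U → inj₂ (cong suc (only z z∈U)) }
∣∣≡2⇒pair (false ∷ U) two =
  let x , y , x≢y , x∈U , y∈U , only = ∣∣≡2⇒pair U two
  in suc x , suc y , x≢y ∘ suc-injective , x∈U , y∈U ,
     λ { (suc z) z∈U → Sum.map (cong suc) (cong suc) (only z z∈U) }

module _ {n} (G : Graph n) where

  small-independent : ∀ U → ∣ U ∣ ≤ 1 → independent G U ≡ true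
  small-independent U ∣U∣≤1 = independent-complete G U no-edge
    where
    no-edge : ∀ {u v} → adj G u v ≡ true → lookup U u ≡ true → lookup U v ≡ true → ⊥
    no-edge {u} {v} uv u∈U v∈U with u ≟ v
    ... | yes refl = true≢false (trans (sym uv) (irrefl G u))
    ... | no u≢v  = ℕ.<⇒≱ (s≤s ∣U∣≤1) (∈₂⇒2≤∣∣ U u≢v u∈U v∈U)

  pair-independent : ∀ U {x y} → lookup U x ≡ true → lookup U y ≡ true → (∀ z → lookup U z ≡ true → z ≡ x ⊎ z ≡ y)
    → independent G U ≡ not (adj G x y)
  pair-independent U {x} {y} x∈U y∈U only with adj G x y in xy
  ... | true  = ¬-not (λ indep → independent-sound G U indep xy x∈U y∈U)
  ... | false = independent-complete G U no-edge
    where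
    no-edge : ∀ {u v} → adj G u v ≡ true → lookup U u ≡ true → lookup U v ≡ true → ⊥
    no-edge {u} {v} uv u∈U v∈U with only u u∈U | only v v∈U
    ... | inj₁ refl | inj₁ refl = true≢false (trans (sym uv) (irrefl G u))
    ... | inj₂ refl | inj₂ refl = true≢false (trans (sym uv) (irrefl G u))
    ... | inj₁ refl | inj₂ refl = true≢false (trans (sym uv) xy)
    ... | inj₂ refl | inj₁ refl = true≢false (trans (sym uv) (trans (Graph.sym G y x) xy))

  XWeight-small : ∀ {j} → j ≤ 1 → XWeight G j ≗ ofSize j
  XWeight-small {j} j≤1 U with ∣ U ∣ ≡ᵇ j in ∣U∣≡j
  ... | true  rewrite small-independent U (subst (_≤ 1) (sym (≡ᵇ⇒≡ ∣U∣≡j)) j≤1) = refl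
  ... | false = *-zeroʳ (𝟙 (independent G U))

½-double : ∀ x → ½ * (x + x) ≡ x
½-double = solve-∀ ℚ-ring

ofSize-1⊛1 : ∀ {m} (U : Subset m) → ½ * (ofSize 1 ⊛ ofSize 1) U ≡ ofSize 2 U
ofSize-1⊛1 []          = refl
ofSize-1⊛1 (false ∷ U) = ofSize-1⊛1 U
ofSize-1⊛1 (true ∷ U)  =
  trans (cong (λ x → ½ * x) (cong₂ _+_ (⊛-identityˡ (ofSize 1) U) (⊛-identityʳ (ofSize 1) U)))
        (½-double (ofSize 1 U))

-- a two-element set is independent in exactly one of G and its complement
independent-xor : ∀ {n} (G : Graph n) U
  → ofSize 2 U - 𝟙 (independent G U) * ofSize 2 U ≡ 𝟙 (independent (complement G) U) * ofSize 2 U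
independent-xor G U with ∣ U ∣ ≡ᵇ 2 in two
... | false = zeros (𝟙 (independent G U)) (𝟙 (independent (complement G) U))
  where
  zeros : ∀ x y → 0ℚ - x * 0ℚ ≡ y * 0ℚ
  zeros = solve-∀ ℚ-ring
... | true  with ∣∣≡2⇒pair U (≡ᵇ⇒≡ two)
... | x , y , x≢y , x∈U , y∈U , only = begin
  1ℚ - 𝟙 (independent G U) * 1ℚ                     ≡⟨ cong (λ b → 1ℚ - 𝟙 b * 1ℚ) (pair-independent G U x∈U y∈U only) ⟩
  1ℚ - 𝟙 (not (adj G x y)) * 1ℚ                     ≡⟨ flip (adj G x y) ⟩
  𝟙 (not (not (adj G x y) ∧ not false)) * 1ℚ        ≡⟨ cong (λ b → 𝟙 (not (not (adj G x y) ∧ not b)) * 1ℚ) (sym (==-≢ x≢y)) ⟩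
  𝟙 (not (adj (complement G) x y)) * 1ℚ             ≡⟨ sym (cong (λ b → 𝟙 b * 1ℚ) (pair-independent (complement G) U x∈U y∈U only)) ⟩
  𝟙 (independent (complement G) U) * 1ℚ             ∎
  where
  open ≡-Reasoning
  flip : ∀ a → 1ℚ - 𝟙 (not a) * 1ℚ ≡ 𝟙 (not (not a ∧ not false)) * 1ℚ
  flip true  = refl
  flip false = refl

splitWeight-XWeight : ∀ {n} (G : Graph n) → splitWeight (XWeight G) ≗ XWeight (complement G) 2
splitWeight-XWeight G U = begin
  ½ * (XWeight G 1 ⊛ XWeight G 1) U - XWeight G 2 U     ≡⟨ cong (λ x → ½ * x - XWeight G 2 U) (⊛-cong singletons singletons U) ⟩
  ½ * (ofSize 1 ⊛ ofSize 1) U - XWeight G 2 U           ≡⟨ cong (_- XWeight G 2 U) (ofSize-1⊛1 U) ⟩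
  ofSize 2 U - XWeight G 2 U                            ≡⟨ independent-xor G U ⟩
  XWeight (complement G) 2 U                            ∎
  where
  open ≡-Reasoning
  singletons : XWeight G 1 ≗ ofSize 1
  singletons = XWeight-small G (s≤s z≤n)

XWeight-complement : ∀ {n} (G : Graph n) {j} → j ≤ 1 → XWeight G j ≗ XWeight (complement G) j
XWeight-complement G j≤1 U = trans (XWeight-small G j≤1 U) (sym (XWeight-small (complement G) j≤1 U))

mult : ∀ {n} → ℕ → Exp n → ℕ
mult {zero}  j α = 0
mult {suc n} j α = (if α zero ≡ᵇ j then 1 else 0) ℕ.+ mult j (α ∘ suc)

AtMost2 : ∀ {n} → Exp n → Set
AtMost2 α = ∀ c → α c ≤ 2

mult-update : ∀ {n} j (α : Exp n) c → mult (suc j) (α [ c ]≔ 0) ℕ.+ (if α c ≡ᵇ suc j then 1 else 0) ≡ mult (suc j) α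
mult-update {suc n} j α zero    = ℕ.+-comm (mult (suc j) (α ∘ suc)) _
mult-update {suc n} j α (suc c) = trans (ℕ.+-assoc (if α zero ≡ᵇ suc j then 1 else 0) _ _)
  (cong ((if α zero ≡ᵇ suc j then 1 else 0) ℕ.+_) (mult-update j (α ∘ suc) c))

mult-update-≡ : ∀ {n} j (α : Exp n) {c} → α c ≡ suc j → mult (suc j) (α [ c ]≔ 0) ≡ ℕ.pred (mult (suc j) α)
mult-update-≡ j α {c} αc = cong ℕ.pred (trans one-more (mult-update j α c))
  where
  one-more : suc (mult (suc j) (α [ c ]≔ 0)) ≡ mult (suc j) (α [ c ]≔ 0) ℕ.+ (if α c ≡ᵇ suc j then 1 else 0)
  one-more rewrite αc | ≡ᵇ-refl j = ℕ.+-comm 1 _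

mult-update-≢ : ∀ {n} j (α : Exp n) {c} → (α c ≡ᵇ suc j) ≡ false → mult (suc j) (α [ c ]≔ 0) ≡ mult (suc j) α
mult-update-≢ j α {c} αc≢ = trans (sym (ℕ.+-identityʳ _))
  (trans (cong (λ b → mult (suc j) (α [ c ]≔ 0) ℕ.+ (if b then 1 else 0)) (sym αc≢)) (mult-update j α c))

sum-𝟙≡mult : ∀ {n} j (α : Exp n) → sum (λ c → 𝟙 (α c ≡ᵇ j)) ≡ ℕtoℚ (mult j α)
sum-𝟙≡mult {zero}  j α = refl
sum-𝟙≡mult {suc n} j α =
  trans (cong₂ _+_ (sym (ℕtoℚ-if (α zero ≡ᵇ j))) (sum-𝟙≡mult j (α ∘ suc))) (sym (ℕtoℚ-+ (if α zero ≡ᵇ j then 1 else 0) (mult j (α ∘ suc))))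

prod-𝟙≡0 : ∀ {n} (α : Exp n) → AtMost2 α → prod (λ c → 𝟙 (α c ≡ᵇ 0)) ≡ 𝟙 ((mult 1 α ≡ᵇ 0) ∧ (mult 2 α ≡ᵇ 0))
prod-𝟙≡0 {zero}  α α≤2 = refl
prod-𝟙≡0 {suc n} α α≤2 with α zero | α≤2 zero
... | 0 | _ = trans (*-identityˡ (prod (λ c → 𝟙 (α (suc c) ≡ᵇ 0)))) (prod-𝟙≡0 (α ∘ suc) (α≤2 ∘ suc))
... | 1 | _ = *-zeroˡ (prod (λ c → 𝟙 (α (suc c) ≡ᵇ 0)))
... | 2 | _ = trans (*-zeroˡ (prod (λ c → 𝟙 (α (suc c) ≡ᵇ 0)))) (cong 𝟙 (sym (∧-zeroʳ (mult 1 (α ∘ suc) ≡ᵇ 0))))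
... | suc (suc (suc _)) | s≤s (s≤s ())

mult-total : ∀ {n} (α : Exp n) → AtMost2 α → mult 0 α ℕ.+ (mult 1 α ℕ.+ mult 2 α) ≡ n
mult-total {zero}  α α≤2 = refl
mult-total {suc n} α α≤2 with α zero | α≤2 zero | mult-total (α ∘ suc) (α≤2 ∘ suc)
... | 0 | _ | total = cong suc total
... | 1 | _ | total = trans (ℕ.+-suc _ _) (cong suc total)
... | 2 | _ | total = trans (cong (mult 0 (α ∘ suc) ℕ.+_) (ℕ.+-suc _ _)) (trans (ℕ.+-suc _ _) (cong suc total))
... | suc (suc (suc _)) | s≤s (s≤s ()) | _

mult-≥3 : ∀ {n} (α : Exp n) → AtMost2 α → ∀ {v} → 3 ≤ v → mult v α ≡ 0
mult-≥3 {zero}  α α≤2 v≥3 = refl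
mult-≥3 {suc n} α α≤2 v≥3@(s≤s (s≤s (s≤s _))) with α zero | α≤2 zero
... | 0 | _ = mult-≥3 (α ∘ suc) (α≤2 ∘ suc) v≥3
... | 1 | _ = mult-≥3 (α ∘ suc) (α≤2 ∘ suc) v≥3
... | 2 | _ = mult-≥3 (α ∘ suc) (α≤2 ∘ suc) v≥3
... | suc (suc (suc _)) | s≤s (s≤s ())

mult-pos : ∀ {n} (α : Exp n) {c v} → α c ≡ v → 1 ≤ mult v α
mult-pos {suc n} α {zero}  refl rewrite ≡ᵇ-refl (α zero) = s≤s z≤n
mult-pos {suc n} α {suc c} αc   = ℕ.≤-trans (mult-pos (α ∘ suc) αc) (ℕ.m≤n+m _ (if α zero ≡ᵇ _ then 1 else 0))

AtMost2-update : ∀ {n} {α : Exp n} → AtMost2 α → ∀ c → AtMost2 (α [ c ]≔ 0)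
AtMost2-update {α = α} α≤2 c c′ with c′ ≟ c
... | yes refl  = subst (_≤ 2) (sym ([]≔-updates α c)) z≤n
... | no c′≢c   = subst (_≤ 2) (sym ([]≔-minimal α c′≢c)) (α≤2 c′)

occ : ℕ → List ℕ → ℕ
occ v = countᵇ (_≡ᵇ v)

onesTwos : List ℕ → Bool
onesTwos = allB (λ x → (x ≡ᵇ 1) ∨ (x ≡ᵇ 2))

sg : ℕ → ℚ
sg zero    = 1ℚ
sg (suc b) = - sg b

-- The coefficient of a monomial with c₁ ones and c₂ twos in (−1)ᵇ m̃ of the partition 1ᵃ 2ᵇ.
closedForm : (a b c₁ c₂ : ℕ) → ℚ
closedForm a b c₁ c₂ = 𝟙 ((c₁ ≡ᵇ a) ∧ (c₂ ≡ᵇ b)) * (sg b * (ℕtoℚ (a !) * ℕtoℚ (b !)))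

closedForm-suc₁ : ∀ a b c₁ c₂ → ℕtoℚ c₁ * closedForm a b (ℕ.pred c₁) c₂ ≡ closedForm (suc a) b c₁ c₂
closedForm-suc₁ a b zero    c₂ = trans (cong (_* closedForm a b 0 c₂) ℕtoℚ-zero)
  (trans (*-zeroˡ (closedForm a b 0 c₂)) (sym (*-zeroˡ Y)))
  where
  Y : ℚ
  Y = sg b * (ℕtoℚ (suc a !) * ℕtoℚ (b !))
closedForm-suc₁ a b (suc c) c₂ = step (c ≡ᵇ a) (c₂ ≡ᵇ b) refl
  where
  K Y : ℚ
  K = sg b * (ℕtoℚ (a !) * ℕtoℚ (b !))
  Y = sg b * (ℕtoℚ (suc a !) * ℕtoℚ (b !))
  zeros : ∀ n x y → n * (0ℚ * x) ≡ 0ℚ * y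
  zeros = solve-∀ ℚ-ring
  step : ∀ t₁ t₂ → (c ≡ᵇ a) ≡ t₁ → ℕtoℚ (suc c) * (𝟙 (t₁ ∧ t₂) * K) ≡ 𝟙 (t₁ ∧ t₂) * Y
  step false t₂ _   = zeros (ℕtoℚ (suc c)) K Y
  step true  t₂ c≡a = begin
    ℕtoℚ (suc c) * (𝟙 t₂ * K)                                    ≡⟨ cong (λ i → ℕtoℚ (suc i) * (𝟙 t₂ * K)) (≡ᵇ⇒≡ {c} {a} c≡a) ⟩
    ℕtoℚ (suc a) * (𝟙 t₂ * K)                                    ≡⟨ rearrange (ℕtoℚ (suc a)) (𝟙 t₂) (sg b) (ℕtoℚ (a !)) (ℕtoℚ (b !)) ⟩
    𝟙 t₂ * (sg b * ((ℕtoℚ (suc a) * ℕtoℚ (a !)) * ℕtoℚ (b !)))  ≡⟨ cong (λ x → 𝟙 t₂ * (sg b * (x * ℕtoℚ (b !)))) (sym (ℕtoℚ-* (suc a) (a !))) ⟩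
    𝟙 t₂ * Y                                                     ∎
    where
    open ≡-Reasoning
    rearrange : ∀ n e s x y → n * (e * (s * (x * y))) ≡ e * (s * ((n * x) * y))
    rearrange = solve-∀ ℚ-ring

closedForm-suc₂ : ∀ a b c₁ c₂ → ℕtoℚ c₂ * (- 1ℚ * closedForm a b c₁ (ℕ.pred c₂)) ≡ closedForm a (suc b) c₁ c₂
closedForm-suc₂ a b c₁ zero    = trans (cong (_* (- 1ℚ * closedForm a b c₁ 0)) ℕtoℚ-zero)
  (trans (*-zeroˡ (- 1ℚ * closedForm a b c₁ 0))
         (sym (trans (cong (λ t → 𝟙 t * Y) (∧-zeroʳ (c₁ ≡ᵇ a))) (*-zeroˡ Y))))
  where
  Y : ℚ
  Y = - sg b * (ℕtoℚ (a !) * ℕtoℚ (suc b !))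
closedForm-suc₂ a b c₁ (suc c) = step (c₁ ≡ᵇ a) (c ≡ᵇ b) refl
  where
  K Y : ℚ
  K = sg b * (ℕtoℚ (a !) * ℕtoℚ (b !))
  Y = - sg b * (ℕtoℚ (a !) * ℕtoℚ (suc b !))
  zeros : ∀ n x y → n * (- 1ℚ * (0ℚ * x)) ≡ 0ℚ * y
  zeros = solve-∀ ℚ-ring
  step : ∀ t₁ t₂ → (c ≡ᵇ b) ≡ t₂ → ℕtoℚ (suc c) * (- 1ℚ * (𝟙 (t₁ ∧ t₂) * K)) ≡ 𝟙 (t₁ ∧ t₂) * Y
  step false t₂    _   = zeros (ℕtoℚ (suc c)) K Y
  step true  false _   = zeros (ℕtoℚ (suc c)) K Y
  step true  true  c≡b = begin
    ℕtoℚ (suc c) * (- 1ℚ * (1ℚ * K))                          ≡⟨ cong (λ i → ℕtoℚ (suc i) * (- 1ℚ * (1ℚ * K))) (≡ᵇ⇒≡ {c} {b} c≡b) ⟩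
    ℕtoℚ (suc b) * (- 1ℚ * (1ℚ * K))                          ≡⟨ rearrange (ℕtoℚ (suc b)) (sg b) (ℕtoℚ (a !)) (ℕtoℚ (b !)) ⟩
    1ℚ * (- sg b * (ℕtoℚ (a !) * (ℕtoℚ (suc b) * ℕtoℚ (b !)))) ≡⟨ cong (λ x → 1ℚ * (- sg b * (ℕtoℚ (a !) * x))) (sym (ℕtoℚ-* (suc b) (b !))) ⟩
    1ℚ * Y                                                     ∎
    where
    open ≡-Reasoning
    rearrange : ∀ n s x y → n * (- 1ℚ * (1ℚ * (s * (x * y)))) ≡ 1ℚ * (- s * (x * (n * y)))
    rearrange = solve-∀ ℚ-ring

φsign : ℕ → ℚ
φsign 1 = 1ℚ
φsign 2 = - 1ℚ
φsign _ = 0ℚ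

φWeight : (l : List ℕ) → ℕ → Subset (length l) → ℚ
φWeight l j U = if j ≡ᵇ 2 then - singleTwo l U else pWeight l j U

-- The coefficient of x^α in φ(p_l) (see eval-φImage), as a weighted colouring.
φValue : ∀ {n} (l : List ℕ) → Exp n → ℚ
φValue l α = Z (length l) (λ c → φWeight l (α c))

zero-coef : ∀ s p → (0ℚ * s) * p ≡ 0ℚ
zero-coef s p = trans (cong (_* p) (*-zeroˡ s)) (*-zeroˡ p)

φWeight-head : ∀ {x l j} → 1 ≤ x → Positive l → j ≤ 2 → ∀ U
  → φWeight (x ∷ l) j (true ∷ U) ≡ (𝟙 (j ≡ᵇ x) * φsign x) * pWeight l 0 U
φWeight-head {suc x}             {l} {0} _ _ _ U = sym (zero-coef (φsign (suc x)) (pWeight l 0 U))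
φWeight-head {1}                 {l} {1} _ _ _ U =
  sym (trans (cong (_* pWeight l 0 U) (*-identityˡ 1ℚ)) (*-identityˡ (pWeight l 0 U)))
φWeight-head {suc (suc x)}       {l} {1} _ _ _ U = sym (zero-coef (φsign (suc (suc x))) (pWeight l 0 U))
φWeight-head {1}                 {l} {2} _ _ _ U =
  trans (cong (λ t → - 𝟙 t) (empty-partSum l U 0)) (sym (zero-coef 1ℚ (pWeight l 0 U)))
φWeight-head {2}                 {l} {2} _ positive _ U = begin
  - 𝟙 ((∣ U ∣ ≡ᵇ 0) ∧ (partSum l U ≡ᵇ 0))       ≡⟨ cong (λ t → - 𝟙 (t ∧ (partSum l U ≡ᵇ 0))) (sym (partSum≡0 positive U)) ⟩
  - 𝟙 ((partSum l U ≡ᵇ 0) ∧ (partSum l U ≡ᵇ 0)) ≡⟨ cong (λ t → - 𝟙 t) (∧-idem (partSum l U ≡ᵇ 0)) ⟩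
  - pWeight l 0 U                                ≡⟨ negate (pWeight l 0 U) ⟩
  (1ℚ * - 1ℚ) * pWeight l 0 U                    ∎
  where
  open ≡-Reasoning
  negate : ∀ p → - p ≡ (1ℚ * - 1ℚ) * p
  negate = solve-∀ ℚ-ring
φWeight-head {suc (suc (suc x))} {l} {2} _ _ _ U =
  trans (cong (λ t → - 𝟙 t) (∧-zeroʳ (∣ U ∣ ≡ᵇ 0))) (sym (zero-coef 0ℚ (pWeight l 0 U)))
φWeight-head {j = suc (suc (suc j))} _ _ (s≤s (s≤s ())) U

φValue-cons : ∀ {n} x l → 1 ≤ x → Positive l → (α : Exp n) → AtMost2 α
  → φValue (x ∷ l) α ≡ sum (λ c₀ → (𝟙 (α c₀ ≡ᵇ x) * φsign x) * φValue l (α [ c₀ ]≔ 0))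
φValue-cons {n} x l x≥1 positive α α≤2 = sum-cong-≗ {n} λ c₀ →
  Z-scale (length l) c₀ (𝟙 (α c₀ ≡ᵇ x) * φsign x) (colour₀ c₀ w) (λ c → φWeight l ((α [ c₀ ]≔ 0) c))
    (λ U → trans (colour₀-≡ w c₀ U)
                 (trans (φWeight-head x≥1 positive (α≤2 c₀) U)
                        (cong (λ j → (𝟙 (α c₀ ≡ᵇ x) * φsign x) * φWeight l j U) (sym ([]≔-updates α c₀)))))
    (λ c c≢c₀ U → trans (cong (λ j → φWeight l j U) ([]≔-minimal α c≢c₀)) (sym (colour₀-≢ w (≢-sym c≢c₀) U)))
  where
  w : Weights n (suc (length l))
  w c = φWeight (x ∷ l) (α c)

φWeight-nil : ∀ j → φWeight [] j [] ≡ 𝟙 (j ≡ᵇ 0)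
φWeight-nil 0                   = refl
φWeight-nil 1                   = refl
φWeight-nil 2                   = refl
φWeight-nil (suc (suc (suc j))) = refl

φValue-closed : ∀ {n} l → Positive l → onesTwos l ≡ true → (α : Exp n) → AtMost2 α
  → φValue l α ≡ closedForm (occ 1 l) (occ 2 l) (mult 1 α) (mult 2 α)
φValue-closed {n} [] _ _ α α≤2 = begin
  prod (λ c → φWeight [] (α c) [])                     ≡⟨ prod-cong-≗ {n} (φWeight-nil ∘ α) ⟩
  prod (λ c → 𝟙 (α c ≡ᵇ 0))                            ≡⟨ prod-𝟙≡0 α α≤2 ⟩
  𝟙 ((mult 1 α ≡ᵇ 0) ∧ (mult 2 α ≡ᵇ 0))                ≡⟨ sym (*-identityʳ _) ⟩
  𝟙 ((mult 1 α ≡ᵇ 0) ∧ (mult 2 α ≡ᵇ 0)) * 1ℚ           ≡⟨ cong (𝟙 ((mult 1 α ≡ᵇ 0) ∧ (mult 2 α ≡ᵇ 0)) *_) one ⟩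
  closedForm 0 0 (mult 1 α) (mult 2 α)                  ∎
  where
  open ≡-Reasoning
  one : 1ℚ ≡ sg 0 * (ℕtoℚ (0 !) * ℕtoℚ (0 !))
  one = refl
φValue-closed {n} (1 ∷ l) (x≥1 ∷ positive) ones α α≤2 = begin
  φValue (1 ∷ l) α                                            ≡⟨ φValue-cons 1 l x≥1 positive α α≤2 ⟩
  sum (λ c₀ → (𝟙 (α c₀ ≡ᵇ 1) * 1ℚ) * φValue l (α [ c₀ ]≔ 0))  ≡⟨ sum-cong-≗ {n} term ⟩
  sum (λ c₀ → 𝟙 (α c₀ ≡ᵇ 1) * F)                             ≡⟨ sym (*-distribʳ-sum F (λ c₀ → 𝟙 (α c₀ ≡ᵇ 1))) ⟩
  sum (λ c₀ → 𝟙 (α c₀ ≡ᵇ 1)) * F                             ≡⟨ cong (_* F) (sum-𝟙≡mult 1 α) ⟩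
  ℕtoℚ (mult 1 α) * F                                         ≡⟨ closedForm-suc₁ (occ 1 l) (occ 2 l) (mult 1 α) (mult 2 α) ⟩
  closedForm (suc (occ 1 l)) (occ 2 l) (mult 1 α) (mult 2 α)  ∎
  where
  open ≡-Reasoning
  F : ℚ
  F = closedForm (occ 1 l) (occ 2 l) (ℕ.pred (mult 1 α)) (mult 2 α)
  term : ∀ c₀ → (𝟙 (α c₀ ≡ᵇ 1) * 1ℚ) * φValue l (α [ c₀ ]≔ 0) ≡ 𝟙 (α c₀ ≡ᵇ 1) * F
  term c₀ = by-cases (α c₀ ≡ᵇ 1) refl
    where
    by-cases : ∀ b → (α c₀ ≡ᵇ 1) ≡ b → (𝟙 b * 1ℚ) * φValue l (α [ c₀ ]≔ 0) ≡ 𝟙 b * F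
    by-cases false _ = trans (zero-coef 1ℚ (φValue l (α [ c₀ ]≔ 0))) (sym (*-zeroˡ F))
    by-cases true αc₀≡1 = trans (cong (_* φValue l (α [ c₀ ]≔ 0)) (*-identityˡ 1ℚ))
      (cong (1ℚ *_) (trans (φValue-closed l positive ones (α [ c₀ ]≔ 0) (AtMost2-update α≤2 c₀))
        (cong₂ (closedForm (occ 1 l) (occ 2 l)) (mult-update-≡ 0 α αc₀) (mult-update-≢ 1 α (cong (_≡ᵇ 2) αc₀)))))
      where
      αc₀ : α c₀ ≡ 1
      αc₀ = ≡ᵇ⇒≡ {α c₀} {1} αc₀≡1
φValue-closed {n} (2 ∷ l) (x≥1 ∷ positive) twos α α≤2 = begin
  φValue (2 ∷ l) α                                                ≡⟨ φValue-cons 2 l x≥1 positive α α≤2 ⟩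
  sum (λ c₀ → (𝟙 (α c₀ ≡ᵇ 2) * - 1ℚ) * φValue l (α [ c₀ ]≔ 0))   ≡⟨ sum-cong-≗ {n} term ⟩
  sum (λ c₀ → 𝟙 (α c₀ ≡ᵇ 2) * (- 1ℚ * F))                         ≡⟨ sym (*-distribʳ-sum (- 1ℚ * F) (λ c₀ → 𝟙 (α c₀ ≡ᵇ 2))) ⟩
  sum (λ c₀ → 𝟙 (α c₀ ≡ᵇ 2)) * (- 1ℚ * F)                         ≡⟨ cong (_* (- 1ℚ * F)) (sum-𝟙≡mult 2 α) ⟩
  ℕtoℚ (mult 2 α) * (- 1ℚ * F)                                    ≡⟨ closedForm-suc₂ (occ 1 l) (occ 2 l) (mult 1 α) (mult 2 α) ⟩
  closedForm (occ 1 l) (suc (occ 2 l)) (mult 1 α) (mult 2 α)      ∎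
  where
  open ≡-Reasoning
  F : ℚ
  F = closedForm (occ 1 l) (occ 2 l) (mult 1 α) (ℕ.pred (mult 2 α))
  term : ∀ c₀ → (𝟙 (α c₀ ≡ᵇ 2) * - 1ℚ) * φValue l (α [ c₀ ]≔ 0) ≡ 𝟙 (α c₀ ≡ᵇ 2) * (- 1ℚ * F)
  term c₀ = by-cases (α c₀ ≡ᵇ 2) refl
    where
    by-cases : ∀ b → (α c₀ ≡ᵇ 2) ≡ b → (𝟙 b * - 1ℚ) * φValue l (α [ c₀ ]≔ 0) ≡ 𝟙 b * (- 1ℚ * F)
    by-cases false _ = trans (zero-coef (- 1ℚ) (φValue l (α [ c₀ ]≔ 0))) (sym (*-zeroˡ (- 1ℚ * F)))
    by-cases true αc₀≡2 = trans (cong (_* φValue l (α [ c₀ ]≔ 0)) (*-identityˡ (- 1ℚ)))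
      (trans (cong (- 1ℚ *_) (trans (φValue-closed l positive twos (α [ c₀ ]≔ 0) (AtMost2-update α≤2 c₀))
        (cong₂ (closedForm (occ 1 l) (occ 2 l)) (mult-update-≢ 0 α (cong (_≡ᵇ 1) αc₀)) (mult-update-≡ 1 α αc₀))))
        (sym (*-identityˡ (- 1ℚ * F))))
      where
      αc₀ : α c₀ ≡ 2
      αc₀ = ≡ᵇ⇒≡ {α c₀} {2} αc₀≡2

φValue-vanishes : ∀ {n} x l → 1 ≤ x → Positive l → (α : Exp n) → AtMost2 α
  → φsign x ≡ 0ℚ ⊎ (∀ c₀ → φValue l (α [ c₀ ]≔ 0) ≡ 0ℚ) → φValue (x ∷ l) α ≡ 0ℚ
φValue-vanishes {n} x l x≥1 positive α α≤2 (inj₁ sign≡0) =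
  trans (φValue-cons x l x≥1 positive α α≤2) (sum-zero {n} _ λ c₀ → begin
    (𝟙 (α c₀ ≡ᵇ x) * φsign x) * φValue l (α [ c₀ ]≔ 0)  ≡⟨ cong (λ s → (𝟙 (α c₀ ≡ᵇ x) * s) * φValue l (α [ c₀ ]≔ 0)) sign≡0 ⟩
    (𝟙 (α c₀ ≡ᵇ x) * 0ℚ) * φValue l (α [ c₀ ]≔ 0)      ≡⟨ cong (_* φValue l (α [ c₀ ]≔ 0)) (*-zeroʳ (𝟙 (α c₀ ≡ᵇ x))) ⟩
    0ℚ * φValue l (α [ c₀ ]≔ 0)                         ≡⟨ *-zeroˡ (φValue l (α [ c₀ ]≔ 0)) ⟩
    0ℚ                                                  ∎)
  where open ≡-Reasoning
φValue-vanishes {n} x l x≥1 positive α α≤2 (inj₂ value≡0) =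
  trans (φValue-cons x l x≥1 positive α α≤2) (sum-zero {n} _ λ c₀ →
    trans (cong ((𝟙 (α c₀ ≡ᵇ x) * φsign x) *_) (value≡0 c₀)) (*-zeroʳ (𝟙 (α c₀ ≡ᵇ x) * φsign x)))

φValue-bad : ∀ {n} l → Positive l → onesTwos l ≡ false → (α : Exp n) → AtMost2 α → φValue l α ≡ 0ℚ
φValue-bad (1 ∷ l) (x≥1 ∷ positive) bad α α≤2 = φValue-vanishes 1 l x≥1 positive α α≤2
  (inj₂ λ c₀ → φValue-bad l positive bad (α [ c₀ ]≔ 0) (AtMost2-update α≤2 c₀))
φValue-bad (2 ∷ l) (x≥1 ∷ positive) bad α α≤2 = φValue-vanishes 2 l x≥1 positive α α≤2
  (inj₂ λ c₀ → φValue-bad l positive bad (α [ c₀ ]≔ 0) (AtMost2-update α≤2 c₀))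
φValue-bad (suc (suc (suc x)) ∷ l) (x≥1 ∷ positive) _ α α≤2 = φValue-vanishes _ l x≥1 positive α α≤2 (inj₁ refl)

nonzeros : ∀ {n} → Exp n → List ℕ
nonzeros α = filter (λ k → ¬? (k ℕ.≟ 0)) (expList α)

occ-nonzeros : ∀ {n} (α : Exp n) v → occ (suc v) (nonzeros α) ≡ mult (suc v) α
occ-nonzeros {n} α v = trans (cong (occ (suc v) ∘ filter (λ k → ¬? (k ℕ.≟ 0))) (map-tabulate id α)) (go α)
  where
  go : ∀ {n} (α : Exp n) → occ (suc v) (filter (λ k → ¬? (k ℕ.≟ 0)) (tabulate α)) ≡ mult (suc v) α
  go {zero}  α = refl
  go {suc n} α with α zero
  ... | zero  = go (α ∘ suc)
  ... | suc k = trans (countᵇ-∷ (_≡ᵇ suc v) (suc k) _) (cong ((if k ≡ᵇ v then 1 else 0) ℕ.+_) (go (α ∘ suc)))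

onesTwos-nonzeros : ∀ {n} (α : Exp n) → AtMost2 α → onesTwos (nonzeros α) ≡ true
onesTwos-nonzeros α α≤2 = trans (cong (onesTwos ∘ filter (λ k → ¬? (k ℕ.≟ 0))) (map-tabulate id α)) (go α α≤2)
  where
  go : ∀ {n} (α : Exp n) → AtMost2 α → onesTwos (filter (λ k → ¬? (k ℕ.≟ 0)) (tabulate α)) ≡ true
  go {zero}  α α≤2 = refl
  go {suc n} α α≤2 with α zero | α≤2 zero
  ... | 0 | _ = go (α ∘ suc) (α≤2 ∘ suc)
  ... | 1 | _ = go (α ∘ suc) (α≤2 ∘ suc)
  ... | 2 | _ = go (α ∘ suc) (α≤2 ∘ suc)
  ... | suc (suc (suc _)) | s≤s (s≤s ())

twosOnes : ℕ → ℕ → List ℕ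
twosOnes b a = replicate b 2 ++ replicate a 1

sortDesc-onesTwos : ∀ l → onesTwos l ≡ true → sortDesc l ≡ twosOnes (occ 2 l) (occ 1 l)
sortDesc-onesTwos []            _    = refl
sortDesc-onesTwos (1 ∷ l)       ones = trans (cong (insert 1) (sortDesc-onesTwos l ones)) (insert-1 (occ 2 l) (occ 1 l))
  where
  insert-1 : ∀ b a → insert 1 (twosOnes b a) ≡ twosOnes b (suc a)
  insert-1 zero    zero    = refl
  insert-1 zero    (suc a) = refl
  insert-1 (suc b) a       = cong (2 ∷_) (insert-1 b a)
sortDesc-onesTwos (2 ∷ l)       twos = trans (cong (insert 2) (sortDesc-onesTwos l twos)) (insert-2 (occ 2 l) (occ 1 l))
  where
  insert-2 : ∀ b a → insert 2 (twosOnes b a) ≡ twosOnes (suc b) a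
  insert-2 zero    zero    = refl
  insert-2 zero    (suc a) = refl
  insert-2 (suc b) a       = refl

listEqᵇ-twosOnes : ∀ b a b′ a′ → listEqᵇ (twosOnes b a) (twosOnes b′ a′) ≡ (b ≡ᵇ b′) ∧ (a ≡ᵇ a′)
listEqᵇ-twosOnes zero    a       zero     a′       = ones a a′
  where
  ones : ∀ a a′ → listEqᵇ (replicate a 1) (replicate a′ 1) ≡ (a ≡ᵇ a′)
  ones zero    zero     = refl
  ones zero    (suc a′) = refl
  ones (suc a) zero     = refl
  ones (suc a) (suc a′) = ones a a′
listEqᵇ-twosOnes zero    zero    (suc b′) a′       = refl
listEqᵇ-twosOnes zero    (suc a) (suc b′) a′       = refl
listEqᵇ-twosOnes (suc b) a       zero     zero     = refl
listEqᵇ-twosOnes (suc b) a       zero     (suc a′) = refl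
listEqᵇ-twosOnes (suc b) a       (suc b′) a′       = listEqᵇ-twosOnes b a b′ a′

m-onesTwos : ∀ {n} l → onesTwos l ≡ true → (α : Exp n) → AtMost2 α
  → m l α ≡ 𝟙 ((mult 1 α ≡ᵇ occ 1 l) ∧ (mult 2 α ≡ᵇ occ 2 l))
m-onesTwos l ones α α≤2 = trans (cong (λ b → if b then 1ℚ else 0ℚ) (begin
  listEqᵇ (sortDesc (nonzeros α)) (sortDesc l)
    ≡⟨ cong₂ listEqᵇ (sortDesc-onesTwos (nonzeros α) (onesTwos-nonzeros α α≤2)) (sortDesc-onesTwos l ones) ⟩
  listEqᵇ (twosOnes (occ 2 (nonzeros α)) (occ 1 (nonzeros α))) (twosOnes (occ 2 l) (occ 1 l))
    ≡⟨ listEqᵇ-twosOnes (occ 2 (nonzeros α)) (occ 1 (nonzeros α)) (occ 2 l) (occ 1 l) ⟩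
  (occ 2 (nonzeros α) ≡ᵇ occ 2 l) ∧ (occ 1 (nonzeros α) ≡ᵇ occ 1 l)
    ≡⟨ ∧-comm (occ 2 (nonzeros α) ≡ᵇ occ 2 l) _ ⟩
  (occ 1 (nonzeros α) ≡ᵇ occ 1 l) ∧ (occ 2 (nonzeros α) ≡ᵇ occ 2 l)
    ≡⟨ cong₂ (λ x y → (x ≡ᵇ occ 1 l) ∧ (y ≡ᵇ occ 2 l)) (occ-nonzeros α 0) (occ-nonzeros α 1) ⟩
  (mult 1 α ≡ᵇ occ 1 l) ∧ (mult 2 α ≡ᵇ occ 2 l)  ∎)) (if-𝟙 _)
  where open ≡-Reasoning

occ-sortDesc : ∀ v L → occ v (sortDesc L) ≡ occ v L
occ-sortDesc v []      = refl
occ-sortDesc v (x ∷ L) = begin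
  occ v (insert x (sortDesc L))                     ≡⟨ occ-insert x (sortDesc L) ⟩
  [ x ] ℕ.+ occ v (sortDesc L)                      ≡⟨ cong ([ x ] ℕ.+_) (occ-sortDesc v L) ⟩
  [ x ] ℕ.+ occ v L                                 ≡⟨ sym (countᵇ-∷ (_≡ᵇ v) x L) ⟩
  occ v (x ∷ L)                                     ∎
  where
  open ≡-Reasoning
  [_] : ℕ → ℕ
  [ x ] = if x ≡ᵇ v then 1 else 0
  occ-insert : ∀ x L → occ v (insert x L) ≡ [ x ] ℕ.+ occ v L
  occ-insert x []       = countᵇ-∷ (_≡ᵇ v) x []
  occ-insert x (y ∷ ys) with y ℕ.≤ᵇ x
  ... | true  = countᵇ-∷ (_≡ᵇ v) x (y ∷ ys)
  ... | false = begin
    occ v (y ∷ insert x ys)           ≡⟨ countᵇ-∷ (_≡ᵇ v) y (insert x ys) ⟩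
    [ y ] ℕ.+ occ v (insert x ys)     ≡⟨ cong ([ y ] ℕ.+_) (occ-insert x ys) ⟩
    [ y ] ℕ.+ ([ x ] ℕ.+ occ v ys)    ≡⟨ x∙yz≈y∙xz [ y ] [ x ] (occ v ys) ⟩
    [ x ] ℕ.+ ([ y ] ℕ.+ occ v ys)    ≡⟨ cong ([ x ] ℕ.+_) (sym (countᵇ-∷ (_≡ᵇ v) y ys)) ⟩
    [ x ] ℕ.+ occ v (y ∷ ys)          ∎

listEqᵇ-sound : ∀ xs ys → listEqᵇ xs ys ≡ true → xs ≡ ys
listEqᵇ-sound []       []       _  = refl
listEqᵇ-sound (x ∷ xs) (y ∷ ys) eq with x ≡ᵇ y in x≡y
... | true = cong₂ _∷_ (≡ᵇ⇒≡ {x} {y} x≡y) (listEqᵇ-sound xs ys eq)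

m-vanishes : ∀ {n} l (α : Exp n) v → occ v (nonzeros α) ≢ occ v l → m l α ≡ 0ℚ
m-vanishes l α v occ≢ with listEqᵇ (sortDesc (nonzeros α)) (sortDesc l) in same
... | false = refl
... | true  = ⊥-elim (occ≢ (begin
  occ v (nonzeros α)              ≡⟨ sym (occ-sortDesc v (nonzeros α)) ⟩
  occ v (sortDesc (nonzeros α))   ≡⟨ cong (occ v) (listEqᵇ-sound (sortDesc (nonzeros α)) (sortDesc l) same) ⟩
  occ v (sortDesc l)              ≡⟨ occ-sortDesc v l ⟩
  occ v l                         ∎))
  where open ≡-Reasoning

occ-≥3 : ∀ l → onesTwos l ≡ true → ∀ {v} → 3 ≤ v → occ v l ≡ 0
occ-≥3 []      _    _                     = refl
occ-≥3 (1 ∷ l) ones v≥3@(s≤s (s≤s (s≤s _))) = occ-≥3 l ones v≥3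
occ-≥3 (2 ∷ l) twos v≥3@(s≤s (s≤s (s≤s _))) = occ-≥3 l twos v≥3

large-part : ∀ l → Positive l → onesTwos l ≡ false → ∃ λ v → 3 ≤ v × 1 ≤ occ v l
large-part (1 ∷ l) (_ ∷ positive) bad with large-part l positive bad
... | v , v≥3@(s≤s (s≤s (s≤s _))) , v∈l = v , v≥3 , v∈l
large-part (2 ∷ l) (_ ∷ positive) bad with large-part l positive bad
... | v , v≥3@(s≤s (s≤s (s≤s _))) , v∈l = v , v≥3 , v∈l
large-part (suc (suc (suc x)) ∷ l) _ _ = suc (suc (suc x)) , s≤s (s≤s (s≤s z≤n)) , x∈l
  where
  x∈l : 1 ≤ occ (suc (suc (suc x))) (suc (suc (suc x)) ∷ l)
  x∈l rewrite countᵇ-∷ (_≡ᵇ suc (suc (suc x))) (suc (suc (suc x))) l | ≡ᵇ-refl x = s≤s z≤n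

m-large-exponent : ∀ {n} l → onesTwos l ≡ true → (α : Exp n) → ∀ c → 3 ≤ α c → m l α ≡ 0ℚ
m-large-exponent l ones α c αc≥3 = vanish (α c) refl αc≥3
  where
  vanish : ∀ v → α c ≡ v → 3 ≤ v → m l α ≡ 0ℚ
  vanish 1 _ (s≤s ())
  vanish 2 _ (s≤s (s≤s ()))
  vanish v@(suc (suc (suc w))) αc v≥3 = m-vanishes l α v λ same →
    ℕ.<⇒≢ (mult-pos α αc) (sym (trans (sym (occ-nonzeros α (suc (suc w)))) (trans same (occ-≥3 l ones v≥3))))

m-large-part : ∀ {n} l → Positive l → onesTwos l ≡ false → (α : Exp n) → AtMost2 α → m l α ≡ 0ℚ
m-large-part l positive bad α α≤2 with large-part l positive bad
... | 1 , s≤s () , _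
... | 2 , s≤s (s≤s ()) , _
... | suc (suc (suc v)) , v≥3 , v∈l = m-vanishes l α (suc (suc (suc v))) λ same →
  ℕ.<⇒≢ v∈l (sym (trans (sym same) (trans (occ-nonzeros α (suc (suc v))) (mult-≥3 α α≤2 v≥3))))

prodOver : (ℕ → ℕ) → List ℕ → ℕ
prodOver f = foldr (λ i acc → f i ℕ.* acc) 1

occurs : ℕ → List ℕ → Bool
occurs v = foldr (λ x acc → (x ≡ᵇ v) ∨ acc) false

prodOver-filter : ∀ f x D → prodOver f (filter (¬? ∘ (x ℕ.≟_)) D) ≡ prodOver (λ i → if x ≡ᵇ i then 1 else f i) D
prodOver-filter f x []      = refl
prodOver-filter f x (d ∷ D) with x ≡ᵇ d
... | true  = trans (prodOver-filter f x D) (sym (ℕ.+-identityʳ _))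
... | false = cong (f d ℕ.*_) (prodOver-filter f x D)

prodOver-deduplicate : ∀ L → onesTwos L ≡ true → ∀ f
  → prodOver f (deduplicate ℕ._≟_ L) ≡ (if occurs 1 L then f 1 else 1) ℕ.* (if occurs 2 L then f 2 else 1)
prodOver-deduplicate []      _    f = refl
prodOver-deduplicate (1 ∷ L) ones f = cong (f 1 ℕ.*_) (begin
  prodOver f (filter (¬? ∘ (1 ℕ.≟_)) (deduplicate ℕ._≟_ L))                     ≡⟨ prodOver-filter f 1 (deduplicate ℕ._≟_ L) ⟩
  prodOver (λ i → if 1 ≡ᵇ i then 1 else f i) (deduplicate ℕ._≟_ L)              ≡⟨ prodOver-deduplicate L ones (λ i → if 1 ≡ᵇ i then 1 else f i) ⟩
  (if occurs 1 L then 1 else 1) ℕ.* (if occurs 2 L then f 2 else 1)             ≡⟨ cong (ℕ._* (if occurs 2 L then f 2 else 1)) (if-same (occurs 1 L)) ⟩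
  1 ℕ.* (if occurs 2 L then f 2 else 1)                                          ≡⟨ ℕ.*-identityˡ _ ⟩
  (if occurs 2 L then f 2 else 1)                                                ∎)
  where
  open ≡-Reasoning
  if-same : ∀ b → (if b then 1 else 1) ≡ 1
  if-same true  = refl
  if-same false = refl
prodOver-deduplicate (2 ∷ L) twos f = begin
  f 2 ℕ.* prodOver f (filter (¬? ∘ (2 ℕ.≟_)) (deduplicate ℕ._≟_ L))              ≡⟨ cong (f 2 ℕ.*_) (prodOver-filter f 2 (deduplicate ℕ._≟_ L)) ⟩
  f 2 ℕ.* prodOver (λ i → if 2 ≡ᵇ i then 1 else f i) (deduplicate ℕ._≟_ L)       ≡⟨ cong (f 2 ℕ.*_) (prodOver-deduplicate L twos (λ i → if 2 ≡ᵇ i then 1 else f i)) ⟩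
  f 2 ℕ.* ((if occurs 1 L then f 1 else 1) ℕ.* (if occurs 2 L then 1 else 1))    ≡⟨ cong (λ x → f 2 ℕ.* ((if occurs 1 L then f 1 else 1) ℕ.* x)) (if-same (occurs 2 L)) ⟩
  f 2 ℕ.* ((if occurs 1 L then f 1 else 1) ℕ.* 1)                                ≡⟨ cong (f 2 ℕ.*_) (ℕ.*-identityʳ _) ⟩
  f 2 ℕ.* (if occurs 1 L then f 1 else 1)                                        ≡⟨ ℕ.*-comm (f 2) (if occurs 1 L then f 1 else 1) ⟩
  (if occurs 1 L then f 1 else 1) ℕ.* f 2                                        ∎
  where
  open ≡-Reasoning
  if-same : ∀ b → (if b then 1 else 1) ≡ 1
  if-same true  = refl
  if-same false = refl

occ-factorial : ∀ v L → (if occurs v L then occ v L ! else 1) ≡ occ v L !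
occ-factorial v L with occurs v L in occurs≡
... | true  = refl
... | false = cong _! (sym (absent L occurs≡))
  where
  absent : ∀ L → occurs v L ≡ false → occ v L ≡ 0
  absent []      _ = refl
  absent (x ∷ L) x∉L with x ≡ᵇ v
  ... | false = absent L x∉L

multFactorial-onesTwos : ∀ l → onesTwos l ≡ true → multFactorial l ≡ occ 1 l ! ℕ.* occ 2 l !
multFactorial-onesTwos l ones = trans (prodOver-deduplicate l ones (λ i → occ i l !))
  (cong₂ ℕ._*_ (occ-factorial 1 l) (occ-factorial 2 l))

sum-onesTwos : ∀ l → onesTwos l ≡ true → foldr ℕ._+_ 0 l ≡ occ 1 l ℕ.+ (occ 2 l ℕ.+ occ 2 l)
sum-onesTwos []      _    = refl
sum-onesTwos (1 ∷ l) ones = cong suc (sum-onesTwos l ones)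
sum-onesTwos (2 ∷ l) twos = trans (cong (λ s → suc (suc s)) (sum-onesTwos l twos)) (sym (shift (occ 1 l) (occ 2 l)))
  where
  shift : ∀ a b → a ℕ.+ (suc b ℕ.+ suc b) ≡ suc (suc (a ℕ.+ (b ℕ.+ b)))
  shift a b = trans (cong (a ℕ.+_) (cong suc (ℕ.+-suc b b))) (trans (ℕ.+-suc a _) (cong suc (ℕ.+-suc a _)))

-- a monomial with more squares than missing variables has degree above n
m-excess-twos : ∀ {n} l → IsPartitionOf n l → (α : Exp n) → AtMost2 α → mult 0 α < mult 2 α
  → onesTwos l ≡ true → m l α ≡ 0ℚ
m-excess-twos {n} l (_ , ∑l≡n) α α≤2 0s<2s ones = trans (m-onesTwos l ones α α≤2) (cong 𝟙 (¬-not mismatch))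
  where
  mismatch : ((mult 1 α ≡ᵇ occ 1 l) ∧ (mult 2 α ≡ᵇ occ 2 l)) ≢ true
  mismatch same with mult 1 α ≡ᵇ occ 1 l in same₁ | mult 2 α ≡ᵇ occ 2 l in same₂
  ... | true | true = ℕ.<⇒≢ 0s<2s (ℕ.+-cancelʳ-≡ (mult 1 α ℕ.+ mult 2 α) (mult 0 α) (mult 2 α) (begin
    mult 0 α ℕ.+ (mult 1 α ℕ.+ mult 2 α)       ≡⟨ mult-total α α≤2 ⟩
    n                                           ≡⟨ sym ∑l≡n ⟩
    foldr ℕ._+_ 0 l                             ≡⟨ sum-onesTwos l ones ⟩
    occ 1 l ℕ.+ (occ 2 l ℕ.+ occ 2 l)           ≡⟨ sym (cong₂ (λ a b → a ℕ.+ (b ℕ.+ b)) (≡ᵇ⇒≡ {mult 1 α} same₁) (≡ᵇ⇒≡ {mult 2 α} same₂)) ⟩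
    mult 1 α ℕ.+ (mult 2 α ℕ.+ mult 2 α)       ≡⟨ x∙yz≈y∙xz (mult 1 α) (mult 2 α) (mult 2 α) ⟩
    mult 2 α ℕ.+ (mult 1 α ℕ.+ mult 2 α)       ∎))
    where open ≡-Reasoning

φImage θImage : List ℕ → LinComb
φImage = foldr (λ k acc → φgen k ⊙ acc) onẽ
θImage = foldr (λ k acc → θgen k ⊙ acc) onẽ

φImage-onesTwos : ∀ l → onesTwos l ≡ true → φImage l ≡ (sg (occ 2 l) , l) ∷ []
φImage-onesTwos []      _    = refl
φImage-onesTwos (1 ∷ l) ones = trans (cong (φgen 1 ⊙_) (φImage-onesTwos l ones))
  (cong (λ c → (c , 1 ∷ l) ∷ []) (*-identityˡ (sg (occ 2 l))))
φImage-onesTwos (2 ∷ l) twos = trans (cong (φgen 2 ⊙_) (φImage-onesTwos l twos))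
  (cong (λ c → (c , 2 ∷ l) ∷ []) (neg (sg (occ 2 l))))
  where
  neg : ∀ x → - 1ℚ * x ≡ - x
  neg = solve-∀ ℚ-ring

θImage-onesTwos : ∀ l → onesTwos l ≡ true → θImage l ≡ (1ℚ , l) ∷ []
θImage-onesTwos []      _    = refl
θImage-onesTwos (1 ∷ l) ones = cong (θgen 1 ⊙_) (θImage-onesTwos l ones)
θImage-onesTwos (2 ∷ l) twos = cong (θgen 2 ⊙_) (θImage-onesTwos l twos)

φImage-bad : ∀ l → onesTwos l ≡ false → φImage l ≡ []
φImage-bad (0 ∷ l)                 _   = refl
φImage-bad (1 ∷ l)                 bad = cong (φgen 1 ⊙_) (φImage-bad l bad)
φImage-bad (2 ∷ l)                 bad = cong (φgen 2 ⊙_) (φImage-bad l bad)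
φImage-bad (suc (suc (suc _)) ∷ l) _   = refl

θImage-bad : ∀ l → onesTwos l ≡ false → θImage l ≡ []
θImage-bad (0 ∷ l)                 _   = refl
θImage-bad (1 ∷ l)                 bad = cong (θgen 1 ⊙_) (θImage-bad l bad)
θImage-bad (2 ∷ l)                 bad = cong (θgen 2 ⊙_) (θImage-bad l bad)
θImage-bad (suc (suc (suc _)) ∷ l) _   = refl

module _ {n} (b : List ℕ → Poly n) (α : Exp n) where

  eval-++ : ∀ L₁ L₂ → eval b (L₁ ++ L₂) α ≡ eval b L₁ α + eval b L₂ α
  eval-++ []              L₂ = sym (+-identityˡ _)
  eval-++ ((q , l) ∷ L₁) L₂ = trans (cong (q * b l α +_) (eval-++ L₁ L₂)) (sym (+-assoc (q * b l α) _ _))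

  eval-scale : ∀ q L → eval b (scale q L) α ≡ q * eval b L α
  eval-scale q []            = sym (*-zeroʳ q)
  eval-scale q ((r , l) ∷ L) = trans (cong ((q * r) * b l α +_) (eval-scale q L)) (distrib q r (b l α) (eval b L α))
    where
    distrib : ∀ q r x y → (q * r) * x + q * y ≡ q * (r * x + y)
    distrib = solve-∀ ℚ-ring

  eval-linear-extension : (T : LinComb → LinComb) (img : List ℕ → LinComb)
    → T [] ≡ [] → (∀ q l E → T ((q , l) ∷ E) ≡ scale q (img l) ++ T E)
    → ∀ E → eval b (T E) α ≡ eval (λ l → eval b (img l)) E α
  eval-linear-extension T img T[] T∷ []            = cong (λ L → eval b L α) T[]
  eval-linear-extension T img T[] T∷ ((q , l) ∷ E) = begin
    eval b (T ((q , l) ∷ E)) α                          ≡⟨ cong (λ L → eval b L α) (T∷ q l E) ⟩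
    eval b (scale q (img l) ++ T E) α                   ≡⟨ eval-++ (scale q (img l)) (T E) ⟩
    eval b (scale q (img l)) α + eval b (T E) α         ≡⟨ cong₂ _+_ (eval-scale q (img l)) (eval-linear-extension T img T[] T∷ E) ⟩
    q * eval b (img l) α + eval (λ l → eval b (img l)) E α  ∎
    where open ≡-Reasoning

eval-φ : ∀ {n} E (α : Exp n) → eval m̃ (φ E) α ≡ eval (λ l → eval m̃ (φImage l)) E α
eval-φ E α = eval-linear-extension m̃ α φ φImage refl (λ _ _ _ → refl) E

eval-θ : ∀ {n} E (α : Exp n) → eval m̃ (θ E) α ≡ eval (λ l → eval m̃ (θImage l)) E α
eval-θ E α = eval-linear-extension m̃ α θ θImage refl (λ _ _ _ → refl) E

eval-cong-homogeneous : ∀ {n} (b₁ b₂ : List ℕ → Poly n) (α : Exp n) {E}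
  → (∀ l → IsPartitionOf n l → b₁ l α ≡ b₂ l α) → Homogeneous n E → eval b₁ E α ≡ eval b₂ E α
eval-cong-homogeneous b₁ b₂ α agree []                     = refl
eval-cong-homogeneous b₁ b₂ α agree (_∷_ {q , l} l⊢n homog) =
  cong₂ (λ x y → q * x + y) (agree l l⊢n) (eval-cong-homogeneous b₁ b₂ α agree homog)

eval-zero-homogeneous : ∀ {n} (b : List ℕ → Poly n) (α : Exp n) {E}
  → (∀ l → IsPartitionOf n l → b l α ≡ 0ℚ) → Homogeneous n E → eval b E α ≡ 0ℚ
eval-zero-homogeneous b α {E} vanish homog =
  trans (eval-cong-homogeneous b (λ _ _ → 0ℚ) α vanish homog) (zeros E)
  where
  zeros : ∀ E → eval {_} (λ _ _ → 0ℚ) E α ≡ 0ℚ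
  zeros []            = refl
  zeros ((q , l) ∷ E) = trans (cong₂ _+_ (*-zeroʳ q) (zeros E)) (+-identityˡ 0ℚ)

eval-φImage : ∀ {n} l → Positive l → (α : Exp n) → AtMost2 α → eval m̃ (φImage l) α ≡ φValue l α
eval-φImage l positive α α≤2 = by-cases (onesTwos l) refl
  where
  by-cases : ∀ b → onesTwos l ≡ b → eval m̃ (φImage l) α ≡ φValue l α
  by-cases false bad  = trans (cong (λ L → eval m̃ L α) (φImage-bad l bad)) (sym (φValue-bad l positive bad α α≤2))
  by-cases true  ones = begin
    eval m̃ (φImage l) α                                            ≡⟨ cong (λ L → eval m̃ L α) (φImage-onesTwos l ones) ⟩
    sg (occ 2 l) * (ℕtoℚ (multFactorial l) * m l α) + 0ℚ           ≡⟨ +-identityʳ _ ⟩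
    sg (occ 2 l) * (ℕtoℚ (multFactorial l) * m l α)                ≡⟨ cong₂ (λ f x → sg (occ 2 l) * (ℕtoℚ f * x))
                                                                        (multFactorial-onesTwos l ones) (m-onesTwos l ones α α≤2) ⟩
    sg (occ 2 l) * (ℕtoℚ (occ 1 l ! ℕ.* occ 2 l !) * 𝟙 matches)    ≡⟨ cong (λ x → sg (occ 2 l) * (x * 𝟙 matches)) (ℕtoℚ-* (occ 1 l !) (occ 2 l !)) ⟩
    sg (occ 2 l) * ((ℕtoℚ (occ 1 l !) * ℕtoℚ (occ 2 l !)) * 𝟙 matches)
                                                                    ≡⟨ rearrange (sg (occ 2 l)) (ℕtoℚ (occ 1 l !)) (ℕtoℚ (occ 2 l !)) (𝟙 matches) ⟩
    closedForm (occ 1 l) (occ 2 l) (mult 1 α) (mult 2 α)           ≡⟨ sym (φValue-closed l positive ones α α≤2) ⟩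
    φValue l α                                                      ∎
    where
    open ≡-Reasoning
    matches : Bool
    matches = (mult 1 α ≡ᵇ occ 1 l) ∧ (mult 2 α ≡ᵇ occ 2 l)
    rearrange : ∀ s x y e → s * ((x * y) * e) ≡ e * (s * (x * y))
    rearrange = solve-∀ ℚ-ring

eval-θImage : ∀ {n} l → Positive l → (α : Exp n) → AtMost2 α → eval m̃ (θImage l) α ≡ m̃ l α
eval-θImage l positive α α≤2 = by-cases (onesTwos l) refl
  where
  by-cases : ∀ b → onesTwos l ≡ b → eval m̃ (θImage l) α ≡ m̃ l α
  by-cases true  ones = trans (cong (λ L → eval m̃ L α) (θImage-onesTwos l ones)) (trans (+-identityʳ _) (*-identityˡ _))
  by-cases false bad  = trans (cong (λ L → eval m̃ L α) (θImage-bad l bad))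
    (sym (trans (cong (ℕtoℚ (multFactorial l) *_) (m-large-part l positive bad α α≤2)) (*-zeroʳ (ℕtoℚ (multFactorial l)))))

module _ {n} (l : List ℕ) (α : Exp n) (m≡0 : onesTwos l ≡ true → m l α ≡ 0ℚ) where

  m̃≡0 : onesTwos l ≡ true → ∀ s → s * m̃ l α + 0ℚ ≡ 0ℚ
  m̃≡0 ones s = trans (cong (λ x → s * (ℕtoℚ (multFactorial l) * x) + 0ℚ) (m≡0 ones)) (zeros s (ℕtoℚ (multFactorial l)))
    where
    zeros : ∀ s f → s * (f * 0ℚ) + 0ℚ ≡ 0ℚ
    zeros = solve-∀ ℚ-ring

  eval-φImage-vanishes : eval m̃ (φImage l) α ≡ 0ℚ
  eval-φImage-vanishes = by-cases (onesTwos l) refl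
    where
    by-cases : ∀ b → onesTwos l ≡ b → eval m̃ (φImage l) α ≡ 0ℚ
    by-cases true  ones = trans (cong (λ L → eval m̃ L α) (φImage-onesTwos l ones)) (m̃≡0 ones (sg (occ 2 l)))
    by-cases false bad  = cong (λ L → eval m̃ L α) (φImage-bad l bad)

  eval-θImage-vanishes : eval m̃ (θImage l) α ≡ 0ℚ
  eval-θImage-vanishes = by-cases (onesTwos l) refl
    where
    by-cases : ∀ b → onesTwos l ≡ b → eval m̃ (θImage l) α ≡ 0ℚ
    by-cases true  ones = trans (cong (λ L → eval m̃ L α) (θImage-onesTwos l ones)) (m̃≡0 ones 1ℚ)
    by-cases false bad  = cong (λ L → eval m̃ L α) (θImage-bad l bad)

positions : ∀ {n} → ℕ → Exp n → List (Fin n)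
positions {n} j α = filter (λ c → α c ℕ.≟ j) (allFin n)

length-positions : ∀ {n} j (α : Exp n) → length (positions j α) ≡ mult j α
length-positions {n} j α = go id
  where
  go : ∀ {k} (f : Fin k → Fin n) → length (filter (λ c → α c ℕ.≟ j) (tabulate f)) ≡ mult j (α ∘ f)
  go {zero}  f = refl
  go {suc k} f with α (f zero) ≡ᵇ j
  ... | true  = cong suc (go (f ∘ suc))
  ... | false = go (f ∘ suc)

module _ {A B : Set} where

  All-zip : ∀ {P : A → Set} {Q : B → Set} {as bs} → All P as → All Q bs
    → All (λ ab → P (proj₁ ab) × Q (proj₂ ab)) (zip as bs)
  All-zip []       _        = []
  All-zip (_ ∷ _)  []       = []
  All-zip (p ∷ ps) (q ∷ qs) = (p , q) ∷ All-zip ps qs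

  AllPairs-zip : ∀ {R : A → A → Set} {S : B → B → Set} {as bs} → AllPairs R as → AllPairs S bs
    → AllPairs (λ ab ab′ → R (proj₁ ab) (proj₁ ab′) × S (proj₂ ab) (proj₂ ab′)) (zip as bs)
  AllPairs-zip []       _        = []
  AllPairs-zip (_ ∷ _)  []       = []
  AllPairs-zip (r ∷ rs) (s ∷ ss) = All-zip r s ∷ AllPairs-zip rs ss

isFirst-zip : ∀ {k} {as bs : List (Fin k)} {c} → length as ≤ length bs → c ∈ as → isFirst (zip as bs) c ≡ true
isFirst-zip {as = a ∷ as} {b ∷ bs} {c} _           (here refl) = cong (_∨ isFirst (zip as bs) c) (==-refl c)
isFirst-zip {as = a ∷ as} {b ∷ bs} {c} (s≤s as≤bs) (there c∈as) =
  trans (cong ((c == a) ∨_) (isFirst-zip as≤bs c∈as)) (∨-zeroʳ (c == a))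

matching : ∀ {n} (α : Exp n) → mult 2 α ≤ mult 0 α
  → ∃ λ P → Matching α P × (∀ c → isFirst P c ≡ (α c ≡ᵇ 2))
matching {n} α 2s≤0s = P , (values , apart) , squares
  where
  P : Pairs n
  P = zip (positions 2 α) (positions 0 α)
  values : All (TwoZero α) P
  values = All-zip (all-filter _ (allFin n)) (all-filter _ (allFin n))
  apart : AllPairs Apart P
  apart = AllPairs-zip (Unique-filter⁺ _ (allFin⁺ n)) (Unique-filter⁺ _ (allFin⁺ n))
  squares : ∀ c → isFirst P c ≡ (α c ≡ᵇ 2)
  squares c with α c ≡ᵇ 2 in αc≡2
  ... | true  = isFirst-zip (subst₂ _≤_ (sym (length-positions 2 α)) (sym (length-positions 0 α)) 2s≤0s)
                            (∈-filter⁺ _ (∈-allFin c) (≡ᵇ⇒≡ {α c} αc≡2))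
  ... | false = isFirst-≢2 P values (≡ᵇ-false⇒≢ {α c} αc≡2)

module _ {n} (α : Exp n) (P : Pairs n) (matched : Matching α P) (squares : ∀ c → isFirst P c ≡ (α c ≡ᵇ 2)) where

  split-p : ∀ l → Positive l → split P (p l) α ≡ φValue l α
  split-p l positive = begin
    split P (p l) α                                          ≡⟨ split-cong P (p≡Z l) α ⟩
    split P (λ β → Z (length l) (pWeight l ∘ β)) α           ≡⟨ split-Z (pWeight l) (pWeight-0 positive) P α matched ⟩
    Z (length l) (splitWeights (pWeight l) P α)              ≡⟨ Z-cong (length l) weight ⟩
    φValue l α                                               ∎
    where
    open ≡-Reasoning
    weight : ∀ c → splitWeights (pWeight l) P α c ≗ φWeight l (α c)
    weight c U = trans (cong (λ b → if b then splitWeight (pWeight l) U else pWeight l (α c) U) (squares c))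
                       (by-cases (α c ≡ᵇ 2))
      where
      by-cases : ∀ b → (if b then splitWeight (pWeight l) U else pWeight l (α c) U)
                       ≡ (if b then - singleTwo l U else pWeight l (α c) U)
      by-cases true  = splitWeight-pWeight positive U
      by-cases false = refl

  split-X : AtMost2 α → ∀ G → split P (X G) α ≡ X (complement G) α
  split-X α≤2 G = begin
    split P (X G) α                                          ≡⟨ split-cong P (X≡Z G) α ⟩
    split P (λ β → Z n (XWeight G ∘ β)) α                    ≡⟨ split-Z (XWeight G) (XWeight-small G z≤n) P α matched ⟩
    Z n (splitWeights (XWeight G) P α)                       ≡⟨ Z-cong n weight ⟩
    Z n (λ c → XWeight (complement G) (α c))                 ≡⟨ sym (X≡Z (complement G) α) ⟩
    X (complement G) α                                       ∎
    where
    open ≡-Reasoning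
    weight : ∀ c → splitWeights (XWeight G) P α c ≗ XWeight (complement G) (α c)
    weight c U = trans (cong (λ b → if b then splitWeight (XWeight G) U else XWeight G (α c) U) (squares c))
                       (by-cases (α c ≡ᵇ 2) refl)
      where
      by-cases : ∀ b → (α c ≡ᵇ 2) ≡ b
        → (if b then splitWeight (XWeight G) U else XWeight G (α c) U) ≡ XWeight (complement G) (α c) U
      by-cases true  αc≡2 = trans (splitWeight-XWeight G U) (cong (λ j → XWeight (complement G) j U) (sym (≡ᵇ⇒≡ {α c} αc≡2)))
      by-cases false αc≢2 = XWeight-complement G (≤1 (α c) αc≢2 (α≤2 c)) U
        where
        ≤1 : ∀ j → (j ≡ᵇ 2) ≡ false → j ≤ 2 → j ≤ 1
        ≤1 0 _ _ = z≤n
        ≤1 1 _ _ = s≤s z≤n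
        ≤1 (suc (suc (suc _))) _ (s≤s (s≤s ()))

  eval-φ≡split : AtMost2 α → ∀ {E} → Homogeneous n E → eval m̃ (φ E) α ≡ split P (eval p E) α
  eval-φ≡split α≤2 {E} homE = begin
    eval m̃ (φ E) α                          ≡⟨ eval-φ E α ⟩
    eval (λ l → eval m̃ (φImage l)) E α      ≡⟨ eval-cong-homogeneous (λ l → eval m̃ (φImage l)) (λ l → split P (p l)) α agree homE ⟩
    eval (λ l → split P (p l)) E α          ≡⟨ sym (split-eval P p E α) ⟩
    split P (eval p E) α                    ∎
    where
    open ≡-Reasoning
    agree : ∀ l → IsPartitionOf n l → eval m̃ (φImage l) α ≡ split P (p l) α
    agree l (positive , _) = trans (eval-φImage l positive α α≤2) (sym (split-p l positive))

classify : ∀ {n} (α : Exp n)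
  → (∀ l → IsPartitionOf n l → onesTwos l ≡ true → m l α ≡ 0ℚ) ⊎ (AtMost2 α × mult 2 α ≤ mult 0 α)
classify {n} α with all? (λ c → α c ℕ.≤? 2)
... | no ¬α≤2 = let c , αc≰2 = ¬∀⟶∃¬ n _ (λ c → α c ℕ.≤? 2) ¬α≤2 in
  inj₁ λ l _ ones → m-large-exponent l ones α c (ℕ.≰⇒> αc≰2)
... | yes α≤2 with mult 2 α ℕ.≤? mult 0 α
...   | yes 2s≤0s = inj₂ (α≤2 , 2s≤0s)
...   | no  2s≰0s = inj₁ λ l l⊢n ones → m-excess-twos l l⊢n α α≤2 (ℕ.≰⇒> 2s≰0s) ones

module _ {n} (α : Exp n) (vanish : ∀ l → IsPartitionOf n l → onesTwos l ≡ true → m l α ≡ 0ℚ) where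

  eval-φ-vanishes : ∀ {E} → Homogeneous n E → eval m̃ (φ E) α ≡ 0ℚ
  eval-φ-vanishes {E} homE = trans (eval-φ E α)
    (eval-zero-homogeneous (λ l → eval m̃ (φImage l)) α (λ l l⊢n → eval-φImage-vanishes l α (vanish l l⊢n)) homE)

  eval-θ-vanishes : ∀ {F} → Homogeneous n F → eval m̃ (θ F) α ≡ 0ℚ
  eval-θ-vanishes {F} homF = trans (eval-θ F α)
    (eval-zero-homogeneous (λ l → eval m̃ (θImage l)) α (λ l l⊢n → eval-θImage-vanishes l α (vanish l l⊢n)) homF)

eval-θ≡eval : ∀ {n} (α : Exp n) → AtMost2 α → ∀ {F} → Homogeneous n F → eval m̃ (θ F) α ≡ eval m̃ F α
eval-θ≡eval {n} α α≤2 {F} homF = trans (eval-θ F α) (eval-cong-homogeneous (λ l → eval m̃ (θImage l)) m̃ α agree homF)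
  where
  agree : ∀ l → IsPartitionOf n l → eval m̃ (θImage l) α ≡ m̃ l α
  agree l (positive , _) = eval-θImage l positive α α≤2

proposition6p3p1 : (n : ℕ) (G : Graph n) (E F : LinComb)
    → Homogeneous n E → Homogeneous n F
    → (∀ α → eval {n} p E α ≡ X G α)
    → (∀ α → eval {n} m̃ F α ≡ X (complement G) α)
    → ∀ α → eval {n} m̃ (φ E) α ≡ eval {n} m̃ (θ F) α
proposition6p3p1 n G E F homE homF E≡X F≡X̄ α = [ degenerate , matched ]′ (classify α)
  where
  degenerate : (∀ l → IsPartitionOf n l → onesTwos l ≡ true → m l α ≡ 0ℚ) → eval m̃ (φ E) α ≡ eval m̃ (θ F) α
  degenerate vanish = trans (eval-φ-vanishes α vanish homE) (sym (eval-θ-vanishes α vanish homF))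

  matched : AtMost2 α × mult 2 α ≤ mult 0 α → eval m̃ (φ E) α ≡ eval m̃ (θ F) α
  matched (α≤2 , 2s≤0s) = along (matching α 2s≤0s)
    where
    along : (∃ λ P → Matching α P × (∀ c → isFirst P c ≡ (α c ≡ᵇ 2))) → eval m̃ (φ E) α ≡ eval m̃ (θ F) α
    along (P , M , squares) = begin
      eval m̃ (φ E) α         ≡⟨ eval-φ≡split α P M squares α≤2 homE ⟩
      split P (eval p E) α   ≡⟨ split-cong P E≡X α ⟩
      split P (X G) α        ≡⟨ split-X α P M squares α≤2 G ⟩
      X (complement G) α     ≡⟨ sym (F≡X̄ α) ⟩
      eval m̃ F α             ≡⟨ sym (eval-θ≡eval α α≤2 homF) ⟩
      eval m̃ (θ F) α         ∎
      where open ≡-Reasoning
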